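{- Let $\ell$ be a prime and $n,N$ positive integers with $n^2\mid N$, $\ell\nmid n$, and $v=\nu_\ell(N)\ge1$. Then for every $e>v$, \[ \#C_{N,n}(\ell^e)=\ell^{3e-v-2}(\ell+1)\left(\ell^{v+1}-\ell^v-1\right). \]
   Context: $C_{N,n}(\ell^e)=\{\sigma\in\mathrm{GL}_2(\mathbb Z/\ell^e\mathbb Z):\det(\sigma)+1-\mathrm{tr}(\sigma)\equiv N\pmod{\ell^e},\ \sigma\equiv I\pmod{\ell^{\nu_\ell(n)}}\}$, with $I$ the identity matrix and $\nu_\ell$ the $\ell$-adic valuation. -}

module Defs where

open import Data.Nat as ℕ using (ℕ; zero; suc; _^_)
open import Data.Nat.Divisibility as ℕD using (_∣?_)
open import Data.Integer as ℤ using (ℤ; +_; ∣_∣)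
open import Data.Fin using (Fin; toℕ)
open import Data.Fin.Properties using (any?)
open import Data.List using (List; length; filter; concatMap; map; [_])
open import Data.List.Base using (allFin)
open import Data.Product using (_×_; _,_; ∃)
open import Relation.Nullary using (Dec; ¬_)
open import Relation.Nullary.Decidable using (_×-dec_)

_≡_[mod_] : ℤ → ℤ → ℕ → Set
x ≡ y [mod m ] = m ℕD.∣ ∣ x ℤ.- y ∣

_≡?_[mod_] : (x y : ℤ) (m : ℕ) → Dec (x ≡ y [mod m ])
x ≡? y [mod m ] = m ∣? ∣ x ℤ.- y ∣

IsVal : ℕ → ℕ → ℕ → Set
IsVal ℓ n k = (ℓ ^ k) ℕD.∣ n × ¬ ((ℓ ^ suc k) ℕD.∣ n)

-- A 2x2 matrix over ℤ/Mℤ, entries given by representatives in Fin M,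
-- σ = (a b ; c d).
Mat2 : ℕ → Set
Mat2 M = Fin M × Fin M × Fin M × Fin M

z : ∀ {M} → Fin M → ℤ
z i = + toℕ i

det : ∀ {M} → Mat2 M → ℤ
det (a , b , c , d) = z a ℤ.* z d ℤ.- z b ℤ.* z c

tr : ∀ {M} → Mat2 M → ℤ
tr (a , b , c , d) = z a ℤ.+ z d

InGL2 : (M : ℕ) → Mat2 M → Set
InGL2 M σ = ∃ λ (u : Fin M) → (det σ ℤ.* z u) ≡ ℤ.1ℤ [mod M ]

InGL2? : (M : ℕ) (σ : Mat2 M) → Dec (InGL2 M σ)
InGL2? M σ = any? (λ u → (det σ ℤ.* z u) ≡? ℤ.1ℤ [mod M ])

≡I : ∀ {M} → Mat2 M → ℕ → Set
≡I (a , b , c , d) m =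
  (z a ≡ ℤ.1ℤ [mod m ]) × (z b ≡ ℤ.0ℤ [mod m ]) × (z c ≡ ℤ.0ℤ [mod m ]) × (z d ≡ ℤ.1ℤ [mod m ])

≡I? : ∀ {M} (σ : Mat2 M) (m : ℕ) → Dec (≡I σ m)
≡I? (a , b , c , d) m =
  (z a ≡? ℤ.1ℤ [mod m ]) ×-dec (z b ≡? ℤ.0ℤ [mod m ]) ×-dec
  (z c ≡? ℤ.0ℤ [mod m ]) ×-dec (z d ≡? ℤ.1ℤ [mod m ])

-- Membership in C_{N,n}(ℓ^e), where k = ν_ℓ(n):
--   σ ∈ GL₂(ℤ/ℓ^eℤ), det σ + 1 - tr σ ≡ N (mod ℓ^e), σ ≡ I (mod ℓ^k).
InC : (ℓ e N k : ℕ) → Mat2 (ℓ ^ e) → Set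
InC ℓ e N k σ =
  InGL2 (ℓ ^ e) σ × ((det σ ℤ.+ ℤ.1ℤ ℤ.- tr σ) ≡ + N [mod ℓ ^ e ]) × ≡I σ (ℓ ^ k)

InC? : (ℓ e N k : ℕ) (σ : Mat2 (ℓ ^ e)) → Dec (InC ℓ e N k σ)
InC? ℓ e N k σ =
  InGL2? (ℓ ^ e) σ ×-dec ((det σ ℤ.+ ℤ.1ℤ ℤ.- tr σ) ≡? + N [mod ℓ ^ e ]) ×-dec ≡I? σ (ℓ ^ k)

allMat2 : (M : ℕ) → List (Mat2 M)
allMat2 M =
  concatMap (λ a → concatMap (λ b → concatMap (λ c → map (λ d → (a , b , c , d))
    (allFin M)) (allFin M)) (allFin M)) (allFin M)

cardC : (ℓ e N k : ℕ) → ℕ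
cardC ℓ e N k = length (filter (InC? ℓ e N k) (allMat2 (ℓ ^ e)))

{-# OPTIONS --safe #-}
module Submission where

-- Since ℓ ∤ n we have ν_ℓ(n) = 0, so σ ∈ C_{N,n}(ℓ^e) means det (I − σ) ≡ N (mod ℓ^e) and det σ a unit;
-- as ℓ ∣ N, the latter says tr σ ≢ 1 (mod ℓ). Sort σ by the first entry among b, c, 1 − a, 1 − d
-- that is a unit mod ℓ: it occurs linearly with a unit coefficient in det (I − σ), so the congruence
-- determines it, and the count is a product of numbers of units and of multiples of ℓ mod ℓ^e.
-- If no entry is a unit then I − σ = ℓ (I − σ′) and the condition becomes det (I − σ′) ≡ N/ℓ²
-- (mod ℓ^(e−2)): impossible unless ℓ² ∣ N, and otherwise ℓ⁴ times the unrestricted count one level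
-- down. For e = v + f + 1, induction on ν_ℓ(N) in steps of two evaluates the unrestricted count
-- #{σ : det (I − σ) ≡ N} = ℓ^(2v+3f+1) (ℓ + 1) (ℓ^(v+1) − 1), and with it the restricted one.

module FiniteSum where

  open import Data.Nat
  open import Data.Nat.Properties
  open import Data.Empty using (⊥-elim)
  open import Function using (_∘_)
  open import Relation.Nullary using (Dec; yes; no; ¬_)
  open import Relation.Nullary.Decidable using (¬?)
  open import Relation.Binary.PropositionalEquality
  open import Data.Nat.Tactic.RingSolver using (solve-∀)

  ∑ : ℕ → (ℕ → ℕ) → ℕ
  ∑ zero    f = 0
  ∑ (suc n) f = f 0 + ∑ n (λ i → f (suc i))

  syntax ∑ n (λ i → e) = ∑[ i < n ] e

  ∑⁴ : ℕ → (ℕ → ℕ → ℕ → ℕ → ℕ) → ℕ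
  ∑⁴ m F = ∑[ a < m ] ∑[ b < m ] ∑[ c < m ] ∑[ d < m ] F a b c d

  𝟙 : ∀ {p} {P : Set p} → Dec P → ℕ
  𝟙 (yes _) = 1
  𝟙 (no _)  = 0

  𝟙-yes : ∀ {p} {P : Set p} (P? : Dec P) → P → 𝟙 P? ≡ 1
  𝟙-yes (yes _) _ = refl
  𝟙-yes (no ¬p) p = ⊥-elim (¬p p)

  𝟙-no : ∀ {p} {P : Set p} (P? : Dec P) → ¬ P → 𝟙 P? ≡ 0
  𝟙-no (yes p) ¬p = ⊥-elim (¬p p)
  𝟙-no (no _)  _  = refl

  𝟙-cong : ∀ {p q} {P : Set p} {Q : Set q} (P? : Dec P) (Q? : Dec Q) →
           (P → Q) → (Q → P) → 𝟙 P? ≡ 𝟙 Q?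
  𝟙-cong (yes _) (yes _)  _ _ = refl
  𝟙-cong (yes p) (no ¬q)  f _ = ⊥-elim (¬q (f p))
  𝟙-cong (no ¬p) (yes q)  _ g = ⊥-elim (¬p (g q))
  𝟙-cong (no _)  (no _)   _ _ = refl

  𝟙-¬+𝟙 : ∀ {p} {P : Set p} (P? : Dec P) (¬P? : Dec (¬ P)) → 𝟙 ¬P? + 𝟙 P? ≡ 1
  𝟙-¬+𝟙 (yes p) (yes ¬p) = ⊥-elim (¬p p)
  𝟙-¬+𝟙 (yes _) (no _)   = refl
  𝟙-¬+𝟙 (no _)  (yes _)  = refl
  𝟙-¬+𝟙 (no ¬p) (no ¬¬p) = ⊥-elim (¬¬p ¬p)

  𝟙-cases : ∀ {p} {P : Set p} (P? : Dec P) {x y z} → (P → x ≡ y) → (¬ P → x ≡ z) → x ≡ 𝟙 P? * y + 𝟙 (¬? P?) * z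
  𝟙-cases (yes p) {y = y} x≡y _ = trans (x≡y p) (sym (trans (+-identityʳ (y + 0)) (+-identityʳ y)))
  𝟙-cases (no ¬p) {z = z} _ x≡z = trans (x≡z ¬p) (sym (+-identityʳ z))

  𝟙*-no : ∀ {p} {P : Set p} (P? : Dec P) x → ¬ P → 𝟙 P? * x ≡ 0
  𝟙*-no P? x ¬p rewrite 𝟙-no P? ¬p = refl

  𝟙*-cong : ∀ {p} {P : Set p} (P? : Dec P) {x y} → (P → x ≡ y) → 𝟙 P? * x ≡ 𝟙 P? * y
  𝟙*-cong (yes p) x≡y = cong (1 *_) (x≡y p)
  𝟙*-cong (no _)  _   = refl

  ∑-cong< : ∀ n {f g : ℕ → ℕ} → (∀ i → i < n → f i ≡ g i) → ∑ n f ≡ ∑ n g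
  ∑-cong< zero    _  = refl
  ∑-cong< (suc n) eq = cong₂ _+_ (eq 0 z<s) (∑-cong< n (λ i i<n → eq (suc i) (s<s i<n)))

  ∑-cong : ∀ n {f g : ℕ → ℕ} → (∀ i → f i ≡ g i) → ∑ n f ≡ ∑ n g
  ∑-cong n eq = ∑-cong< n (λ i _ → eq i)

  ∑-distrib-+ : ∀ n (f g : ℕ → ℕ) → ∑[ i < n ] (f i + g i) ≡ ∑ n f + ∑ n g
  ∑-distrib-+ zero    f g = refl
  ∑-distrib-+ (suc n) f g rewrite ∑-distrib-+ n (λ i → f (suc i)) (λ i → g (suc i)) =
    interchange (f 0) (g 0) _ _
    where
    interchange : ∀ a b c d → (a + b) + (c + d) ≡ (a + c) + (b + d)
    interchange = solve-∀

  *-distribˡ-∑ : ∀ n k (f : ℕ → ℕ) → ∑[ i < n ] (k * f i) ≡ k * ∑ n f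
  *-distribˡ-∑ zero    k f = sym (*-zeroʳ k)
  *-distribˡ-∑ (suc n) k f rewrite *-distribˡ-∑ n k (λ i → f (suc i)) =
    sym (*-distribˡ-+ k (f 0) _)

  *-distribʳ-∑ : ∀ n k (f : ℕ → ℕ) → ∑[ i < n ] (f i * k) ≡ ∑ n f * k
  *-distribʳ-∑ n k f = begin
    ∑[ i < n ] (f i * k) ≡⟨ ∑-cong n (λ i → *-comm (f i) k) ⟩
    ∑[ i < n ] (k * f i) ≡⟨ *-distribˡ-∑ n k f ⟩
    k * ∑ n f            ≡⟨ *-comm k _ ⟩
    ∑ n f * k            ∎
    where open ≡-Reasoning

  *-distribˡ-∑² : ∀ n k (f : ℕ → ℕ → ℕ) → ∑[ i < n ] ∑[ j < n ] (k * f i j) ≡ k * ∑[ i < n ] ∑[ j < n ] f i j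
  *-distribˡ-∑² n k f = trans (∑-cong n (λ i → *-distribˡ-∑ n k (f i))) (*-distribˡ-∑ n k _)

  *-distribˡ-∑³ : ∀ n k (f : ℕ → ℕ → ℕ → ℕ) →
                  ∑[ i < n ] ∑[ j < n ] ∑[ l < n ] (k * f i j l) ≡ k * ∑[ i < n ] ∑[ j < n ] ∑[ l < n ] f i j l
  *-distribˡ-∑³ n k f = trans (∑-cong n (λ i → *-distribˡ-∑² n k (f i))) (*-distribˡ-∑ n k _)

  ∑-const : ∀ n k → ∑[ _ < n ] k ≡ n * k
  ∑-const zero    k = refl
  ∑-const (suc n) k = cong (k +_) (∑-const n k)

  ∑-zero : ∀ n {f : ℕ → ℕ} → (∀ i → i < n → f i ≡ 0) → ∑ n f ≡ 0
  ∑-zero n {f} f≡0 = trans (∑-cong< n f≡0) (trans (∑-const n 0) (*-zeroʳ n))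

  ∑-split : ∀ m n (f : ℕ → ℕ) → ∑ (m + n) f ≡ ∑ m f + ∑[ i < n ] f (m + i)
  ∑-split zero    n f = refl
  ∑-split (suc m) n f rewrite ∑-split m n (λ i → f (suc i)) = sym (+-assoc (f 0) _ _)

  ∑-comm : ∀ m n (f : ℕ → ℕ → ℕ) →
           ∑[ i < m ] ∑[ j < n ] f i j ≡ ∑[ j < n ] ∑[ i < m ] f i j
  ∑-comm zero    n f = sym (∑-zero n (λ _ _ → refl))
  ∑-comm (suc m) n f rewrite ∑-comm m n (λ i j → f (suc i) j) =
    sym (∑-distrib-+ n (f 0) (λ j → ∑[ i < m ] f (suc i) j))

  ∑-single : ∀ n {f : ℕ → ℕ} i₀ → i₀ < n → (∀ i → i < n → i ≢ i₀ → f i ≡ 0) → ∑ n f ≡ f i₀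
  ∑-single (suc n) {f} zero _ others =
    trans (cong (f 0 +_) (∑-zero n (λ i i<n → others (suc i) (s<s i<n) (λ ())))) (+-identityʳ (f 0))
  ∑-single (suc n) {f} (suc i₀) (s<s i₀<n) others =
    cong₂ _+_ (others 0 z<s (λ ()))
              (∑-single n i₀ i₀<n (λ i i<n i≢i₀ → others (suc i) (s<s i<n) (i≢i₀ ∘ suc-injective)))

  ∑-translate : ∀ n s (f : ℕ → ℕ) → (∀ i → f (n + i) ≡ f i) → ∑[ i < n ] f (s + i) ≡ ∑ n f
  ∑-translate n zero    f per = refl
  ∑-translate n (suc s) f per = begin
    ∑[ i < n ] f (suc s + i)      ≡⟨ ∑-cong n (λ i → cong f (sym (+-suc s i))) ⟩
    ∑[ i < n ] f (s + suc i)      ≡⟨ +-cancelˡ-≡ (f s) _ _ rotate ⟩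
    ∑[ i < n ] f (s + i)          ≡⟨ ∑-translate n s f per ⟩
    ∑ n f                         ∎
    where
    open ≡-Reasoning
    rotate : f s + ∑[ i < n ] f (s + suc i) ≡ f s + ∑[ i < n ] f (s + i)
    rotate = begin
      f s + ∑[ i < n ] f (s + suc i)         ≡⟨ cong (λ k → f k + ∑[ i < n ] f (s + suc i)) (sym (+-identityʳ s)) ⟩
      ∑ (suc n) (λ i → f (s + i))            ≡⟨ cong (λ k → ∑ k (λ i → f (s + i))) (+-comm 1 n) ⟩
      ∑ (n + 1) (λ i → f (s + i))            ≡⟨ ∑-split n 1 (λ i → f (s + i)) ⟩
      ∑[ i < n ] f (s + i) + (f (s + (n + 0)) + 0) ≡⟨ cong (∑[ i < n ] f (s + i) +_) wrap ⟩
      ∑[ i < n ] f (s + i) + f s             ≡⟨ +-comm _ (f s) ⟩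
      f s + ∑[ i < n ] f (s + i)             ∎
      where
      wrap : f (s + (n + 0)) + 0 ≡ f s
      wrap rewrite +-identityʳ (f (s + (n + 0))) | +-identityʳ n | +-comm s n = per s

  ∑-periodic : ∀ q k (f : ℕ → ℕ) → (∀ i → f (k + i) ≡ f i) → ∑ (q * k) f ≡ q * ∑ k f
  ∑-periodic zero    k f per = refl
  ∑-periodic (suc q) k f per =
    trans (∑-split k (q * k) f) (cong (∑ k f +_) (trans (∑-cong (q * k) per) (∑-periodic q k f per)))

  ∑⁴-cong : ∀ m {F G : ℕ → ℕ → ℕ → ℕ → ℕ} → (∀ a b c d → F a b c d ≡ G a b c d) → ∑⁴ m F ≡ ∑⁴ m G
  ∑⁴-cong m eq = ∑-cong m λ a → ∑-cong m λ b → ∑-cong m λ c → ∑-cong m λ d → eq a b c d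

  ∑⁴-distrib-+ : ∀ m F G → ∑⁴ m (λ a b c d → F a b c d + G a b c d) ≡ ∑⁴ m F + ∑⁴ m G
  ∑⁴-distrib-+ m F G =
    trans (∑-cong m λ a → trans (∑-cong m λ b → trans (∑-cong m λ c → ∑-distrib-+ m (F a b c) (G a b c))
                                                   (∑-distrib-+ m _ _))
                             (∑-distrib-+ m _ _))
          (∑-distrib-+ m _ _)

  ∑⁴-periodic : ∀ q k (F : ℕ → ℕ → ℕ → ℕ → ℕ) →
    (∀ a b c d → F (k + a) b c d ≡ F a b c d) → (∀ a b c d → F a (k + b) c d ≡ F a b c d) →
    (∀ a b c d → F a b (k + c) d ≡ F a b c d) → (∀ a b c d → F a b c (k + d) ≡ F a b c d) →
    ∑⁴ (q * k) F ≡ q * (q * (q * (q * ∑⁴ k F)))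
  ∑⁴-periodic q k F perᵃ perᵇ perᶜ perᵈ =
    trans (∑-cong (q * k) λ a → trans (∑-cong (q * k) λ b → inner a b) (middle a)) outer
    where
    inner : ∀ a b → ∑[ c < q * k ] ∑[ d < q * k ] F a b c d ≡ q * (q * ∑[ c < k ] ∑[ d < k ] F a b c d)
    inner a b = trans (∑-cong (q * k) λ c → ∑-periodic q k _ (perᵈ a b c))
                (trans (*-distribˡ-∑ (q * k) q _)
                       (cong (q *_) (∑-periodic q k _ (λ c → ∑-cong k (λ d → perᶜ a b c d)))))
    middle : ∀ a → ∑[ b < q * k ] (q * (q * ∑[ c < k ] ∑[ d < k ] F a b c d)) ≡
                   q * (q * (q * ∑[ b < k ] ∑[ c < k ] ∑[ d < k ] F a b c d))
    middle a = trans (*-distribˡ-∑ (q * k) q _) (cong (q *_) (trans (*-distribˡ-∑ (q * k) q _) (cong (q *_)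
                 (∑-periodic q k _ (λ b → ∑-cong k (λ c → ∑-cong k (λ d → perᵇ a b c d)))))))
    outer : ∑[ a < q * k ] (q * (q * (q * ∑[ b < k ] ∑[ c < k ] ∑[ d < k ] F a b c d))) ≡
            q * (q * (q * (q * ∑⁴ k F)))
    outer = trans (*-distribˡ-∑ (q * k) q _) (cong (q *_) (trans (*-distribˡ-∑ (q * k) q _) (cong (q *_)
              (trans (*-distribˡ-∑ (q * k) q _) (cong (q *_) periodic)))))
      where
      periodic : ∑[ a < q * k ] ∑[ b < k ] ∑[ c < k ] ∑[ d < k ] F a b c d ≡ q * ∑⁴ k F
      periodic = ∑-periodic q k _ (λ a → ∑-cong k (λ b → ∑-cong k (λ c → ∑-cong k (λ d → perᵃ a b c d))))

  *-distribˡ-∑⁴ : ∀ m k F → ∑⁴ m (λ a b c d → k * F a b c d) ≡ k * ∑⁴ m F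
  *-distribˡ-∑⁴ m k F = trans (∑-cong m (λ a → *-distribˡ-∑³ m k (F a))) (*-distribˡ-∑ m k _)

  ∑⁴-zero : ∀ m {F : ℕ → ℕ → ℕ → ℕ → ℕ} → (∀ a b c d → F a b c d ≡ 0) → ∑⁴ m F ≡ 0
  ∑⁴-zero m F≡0 =
    ∑-zero m λ a _ → ∑-zero m λ b _ → ∑-zero m λ c _ → ∑-zero m λ d _ → F≡0 a b c d

module Congruence where

  open import Data.Nat as ℕ using (ℕ; zero; suc; _^_)
  import Data.Nat.Properties as ℕ
  import Data.Nat.Divisibility as ℕ
  open import Data.Nat.Primality using (Prime; euclidsLemma; prime⇒irreducible; prime⇒nonZero; prime⇒nonTrivial)
  open import Data.Nat.Coprimality using (Coprime; coprime-Bézout)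
  open import Data.Nat.GCD using (module Bézout)
  open import Data.Integer hiding (suc; _^_; ∣_∣)
  import Data.Integer as ℤ using (∣_∣)
  open import Data.Integer.Properties
  open import Data.Integer.DivMod using (a≡a%ℕn+[a/ℕn]*n; n%ℕd<d; _%ℕ_; _/ℕ_)
  open import Data.Integer.Divisibility.Signed public
  open import Data.Product using (_×_; _,_; Σ-syntax)
  open import Data.Sum using (_⊎_; inj₁; inj₂)
  open import Data.Empty using (⊥-elim)
  open import Relation.Nullary using (¬_; contradiction)
  open import Relation.Binary.PropositionalEquality
  open import Data.Integer.Tactic.RingSolver using (solve-∀)

  ∣-respʳ : ∀ {m x y} → x ≡ y → m ∣ x → m ∣ y
  ∣-respʳ refl m∣x = m∣x

  ∣x-x : ∀ {m} x → m ∣ (x - x)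
  ∣x-x x = ∣-respʳ (sym (+-inverseʳ x)) (divides 0ℤ refl)

  ∣x-y⇒∣y-x : ∀ {m} x y → m ∣ (x - y) → m ∣ (y - x)
  ∣x-y⇒∣y-x x y m∣x-y = ∣-respʳ (neg-minus x y) (∣m⇒∣-m m∣x-y)
    where
    neg-minus : ∀ x y → - (x - y) ≡ y - x
    neg-minus = solve-∀

  ∤-neg : ∀ {m} x → ¬ (m ∣ x) → ¬ (m ∣ - x)
  ∤-neg x m∤x m∣-x = m∤x (∣-respʳ (neg-involutive x) (∣m⇒∣-m m∣-x))

  ∣x-y∧∣x⇒∣y : ∀ {m} x y → m ∣ (x - y) → m ∣ x → m ∣ y
  ∣x-y∧∣x⇒∣y x y m∣x-y m∣x = ∣-respʳ (x-[x-y]≡y x y) (∣m∣n⇒∣m-n m∣x m∣x-y)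
    where
    x-[x-y]≡y : ∀ x y → x - (x - y) ≡ y
    x-[x-y]≡y = solve-∀

  sub-cong : ∀ {m} x x′ y y′ → m ∣ (x - x′) → m ∣ (y - y′) → m ∣ ((x - y) - (x′ - y′))
  sub-cong x x′ y y′ p q = ∣-respʳ (regroup x x′ y y′) (∣m∣n⇒∣m-n p q)
    where
    regroup : ∀ x x′ y y′ → (x - x′) - (y - y′) ≡ (x - y) - (x′ - y′)
    regroup = solve-∀

  mul-cong : ∀ {m} x x′ y y′ → m ∣ (x - x′) → m ∣ (y - y′) → m ∣ ((x * y) - (x′ * y′))
  mul-cong x x′ y y′ p q = ∣-respʳ (regroup x x′ y y′) (∣m∣n⇒∣m+n (∣m⇒∣m*n y p) (∣n⇒∣m*n x′ q))
    where
    regroup : ∀ x x′ y y′ → (x - x′) * y + x′ * (y - y′) ≡ (x * y) - (x′ * y′)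
    regroup = solve-∀

  -- det (I − σ) − N for σ = (A B ; C D), i.e. det σ + 1 − tr σ − N.
  defect : ℤ → ℤ → ℤ → ℤ → ℤ → ℤ
  defect N A B C D = (1ℤ - A) * (1ℤ - D) - B * C - N

  defect-cong : ∀ {m} N A A′ B B′ C C′ D D′ →
                m ∣ (A - A′) → m ∣ (B - B′) → m ∣ (C - C′) → m ∣ (D - D′) →
                m ∣ (defect N A B C D - defect N A′ B′ C′ D′)
  defect-cong N A A′ B B′ C C′ D D′ pa pb pc pd =
    sub-cong ((1ℤ - A) * (1ℤ - D) - B * C) ((1ℤ - A′) * (1ℤ - D′) - B′ * C′) N N
      (sub-cong ((1ℤ - A) * (1ℤ - D)) ((1ℤ - A′) * (1ℤ - D′)) (B * C) (B′ * C′)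
        (mul-cong (1ℤ - A) (1ℤ - A′) (1ℤ - D) (1ℤ - D′)
          (sub-cong 1ℤ 1ℤ A A′ (∣x-x 1ℤ) pa) (sub-cong 1ℤ 1ℤ D D′ (∣x-x 1ℤ) pd))
        (mul-cong B B′ C C′ pb pc))
      (∣x-x N)

  representative : ∀ m .{{_ : ℕ.NonZero m}} (r : ℤ) → Σ[ i ∈ ℕ ] (i ℕ.< m × + m ∣ (+ i - r))
  representative m r =
    r %ℕ m , n%ℕd<d r m ,
    ∣-respʳ (division (+ (r %ℕ m)) (r /ℕ m) (+ m) r (a≡a%ℕn+[a/ℕn]*n r m)) (∣m⇒∣-m (∣n⇒∣m*n (r /ℕ m) ∣-refl))
    where
    division : ∀ a q k r → r ≡ a + q * k → - (q * k) ≡ a - r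
    division a q k _ refl = cancel a q k
      where
      cancel : ∀ a q k → - (q * k) ≡ a - (a + q * k)
      cancel = solve-∀

  representative-unique : ∀ {m i j} → i ℕ.< m → j ℕ.< m → + m ∣ (+ i - + j) → i ≡ j
  representative-unique {m} {i} {j} i<m j<m m∣i-j =
    +-injective (i-j≡0⇒i≡j (+ i) (+ j) (∣i∣≡0⇒i≡0 (small (∣⇒∣ᵤ m∣i-j) bound)))
    where
    bound : ℤ.∣ + i - + j ∣ ℕ.< m
    bound = subst (ℕ._< m) (cong ℤ.∣_∣ (sym (m-n≡m⊖n i j))) (ℕ.≤-<-trans (∣m⊝n∣≤m⊔n i j) (ℕ.⊔-pres-<m i<m j<m))
    small : ∀ {n} → m ℕ.∣ n → n ℕ.< m → n ≡ 0
    small {zero}  _   _   = refl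
    small {suc n} m∣n n<m = contradiction m∣n (ℕ.>⇒∤ n<m)

  prime≥2 : ∀ {ℓ} → Prime ℓ → 2 ℕ.≤ ℓ
  prime≥2 {ℓ} pr = ℕ.nonTrivial⇒n>1 ℓ {{prime⇒nonTrivial pr}}

  prime∤1 : ∀ {ℓ} → Prime ℓ → ¬ (+ ℓ ∣ 1ℤ)
  prime∤1 pr ℓ∣1 = contradiction (ℕ.∣⇒≤ (∣⇒∣ᵤ ℓ∣1)) (ℕ.<⇒≱ (prime≥2 pr))

  euclidsLemmaℤ : ∀ {ℓ} → Prime ℓ → ∀ x y → + ℓ ∣ (x * y) → + ℓ ∣ x ⊎ + ℓ ∣ y
  euclidsLemmaℤ {ℓ} pr x y ℓ∣xy with euclidsLemma ℤ.∣ x ∣ ℤ.∣ y ∣ pr (subst (ℓ ℕ.∣_) (abs-* x y) (∣⇒∣ᵤ ℓ∣xy))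
  ... | inj₁ ℓ∣x = inj₁ (∣ᵤ⇒∣ ℓ∣x)
  ... | inj₂ ℓ∣y = inj₂ (∣ᵤ⇒∣ ℓ∣y)

  ℓ∣ℓ^suc : ∀ ℓ j → + ℓ ∣ + (ℓ ^ suc j)
  ℓ∣ℓ^suc ℓ j = ∣ᵤ⇒∣ (ℕ.m∣m*n (ℓ ^ j))

  ℓ^suc∣ℓ*x⇒ℓ^∣x : ∀ {ℓ} → Prime ℓ → ∀ j x → + (ℓ ^ suc j) ∣ (+ ℓ * x) → + (ℓ ^ j) ∣ x
  ℓ^suc∣ℓ*x⇒ℓ^∣x {ℓ} pr j x p = *-cancelˡ-∣ (+ ℓ) {{prime⇒nonZero pr}} (subst (_∣ (+ ℓ * x)) (pos-* ℓ (ℓ ^ j)) p)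

  ℓ^∣x⇒ℓ^suc∣ℓ*x : ∀ ℓ j x → + (ℓ ^ j) ∣ x → + (ℓ ^ suc j) ∣ (+ ℓ * x)
  ℓ^∣x⇒ℓ^suc∣ℓ*x ℓ j x p = subst (_∣ (+ ℓ * x)) (sym (pos-* ℓ (ℓ ^ j))) (*-monoʳ-∣ (+ ℓ) p)

  ℓ²∣ℓ^suc-suc : ∀ ℓ j → + (ℓ ℕ.* ℓ) ∣ + (ℓ ^ suc (suc j))
  ℓ²∣ℓ^suc-suc ℓ j = ∣ᵤ⇒∣ (subst ((ℓ ℕ.* ℓ) ℕ.∣_) (ℕ.*-assoc ℓ ℓ (ℓ ^ j)) (ℕ.m∣m*n (ℓ ^ j)))

  private
    signed-abs : ∀ x → Σ[ s ∈ ℤ ] (x * s ≡ + ℤ.∣ x ∣)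
    signed-abs (+ n)    = 1ℤ , *-identityʳ (+ n)
    signed-abs -[1+ n ] = -1ℤ , trans (*-comm -[1+ n ] -1ℤ) (-1*i≡-i -[1+ n ])

    inverse-mod-prime : ∀ {ℓ} → Prime ℓ → ∀ x → ¬ (+ ℓ ∣ x) → Σ[ u ∈ ℤ ] (+ ℓ ∣ (x * u - 1ℤ))
    inverse-mod-prime {ℓ} pr x ℓ∤x with coprime-Bézout coprime | signed-abs x
      where
      coprime : Coprime ℓ ℤ.∣ x ∣
      coprime {d} (d∣ℓ , d∣x) with prime⇒irreducible pr d∣ℓ
      ... | inj₁ d≡1    = d≡1
      ... | inj₂ refl   = ⊥-elim (ℓ∤x (∣ᵤ⇒∣ d∣x))
    ... | Bézout.+- a b eq | s , xs≡∣x∣ =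
      - + b * s , divides (- + a) (identity x s (+ b) (+ a) _ xs≡∣x∣ bézout)
      where
      bézout : 1ℤ + + b * + ℤ.∣ x ∣ ≡ + a * + ℓ
      bézout = trans (cong (λ t → 1ℤ + t) (sym (pos-* b ℤ.∣ x ∣)))
                 (trans (sym (pos-+ 1 (b ℕ.* ℤ.∣ x ∣))) (trans (cong +_ eq) (pos-* a ℓ)))
      identity : ∀ x s b a n → x * s ≡ n → 1ℤ + b * n ≡ a * + ℓ → x * (- b * s) - 1ℤ ≡ - a * + ℓ
      identity x s b a _ refl e = trans (normalise x s b) (trans (cong -_ e) (neg-distribˡ-* a (+ ℓ)))
        where
        normalise : ∀ x s b → x * (- b * s) - 1ℤ ≡ - (1ℤ + b * (x * s))
        normalise = solve-∀
    ... | Bézout.-+ a b eq | s , xs≡∣x∣ =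
      + b * s , divides (+ a) (identity x s (+ b) (+ a) _ xs≡∣x∣ bézout)
      where
      bézout : 1ℤ + + a * + ℓ ≡ + b * + ℤ.∣ x ∣
      bézout = trans (cong (λ t → 1ℤ + t) (sym (pos-* a ℓ)))
                 (trans (sym (pos-+ 1 (a ℕ.* ℓ))) (trans (cong +_ eq) (pos-* b ℤ.∣ x ∣)))
      identity : ∀ x s b a n → x * s ≡ n → 1ℤ + a * + ℓ ≡ b * n → x * (b * s) - 1ℤ ≡ a * + ℓ
      identity x s b a _ refl e = trans (normalise x s b) (trans (cong (_- 1ℤ) (sym e)) (cancel (a * + ℓ)))
        where
        normalise : ∀ x s b → x * (b * s) - 1ℤ ≡ b * (x * s) - 1ℤ
        normalise = solve-∀
        cancel : ∀ y → 1ℤ + y - 1ℤ ≡ y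
        cancel = solve-∀

  -- Newton step: for u′ = u (2 − x u), x u′ − 1 = −(x u − 1)², so an inverse mod ℓ^(k+1) lifts mod ℓ^(k+2).
  inverse-mod-prime-power : ∀ {ℓ} → Prime ℓ → ∀ x → ¬ (+ ℓ ∣ x) → ∀ j → Σ[ u ∈ ℤ ] (+ (ℓ ^ j) ∣ (x * u - 1ℤ))
  inverse-mod-prime-power pr x ℓ∤x zero = 0ℤ , divides (x * 0ℤ - 1ℤ) (sym (*-identityʳ _))
  inverse-mod-prime-power {ℓ} pr x ℓ∤x (suc zero) with inverse-mod-prime pr x ℓ∤x
  ... | u , ℓ∣xu-1 = u , subst (λ k → + k ∣ (x * u - 1ℤ)) (sym (ℕ.*-identityʳ ℓ)) ℓ∣xu-1
  inverse-mod-prime-power {ℓ} pr x ℓ∤x (suc (suc j)) with inverse-mod-prime-power pr x ℓ∤x (suc j)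
  ... | u , ℓ^∣w = u * (1ℤ - w) , ∣-respʳ (lift x u) (∣m⇒∣-m ℓ^suc∣w²)
    where
    w : ℤ
    w = x * u - 1ℤ
    lift : ∀ x u → - ((x * u - 1ℤ) * (x * u - 1ℤ)) ≡ x * (u * (1ℤ - (x * u - 1ℤ))) - 1ℤ
    lift = solve-∀
    ℓ^suc∣w² : + (ℓ ^ suc (suc j)) ∣ (w * w)
    ℓ^suc∣w² = subst (_∣ (w * w)) (sym (pos-* ℓ (ℓ ^ suc j)))
                 (∣-trans (*-monoˡ-∣ (+ (ℓ ^ suc j)) (∣-trans (ℓ∣ℓ^suc ℓ j) ℓ^∣w)) (*-monoʳ-∣ w ℓ^∣w))

module LinearCongruence where

  open import Data.Nat as ℕ using (ℕ; suc; _^_)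
  import Data.Nat.Properties as ℕ
  open import Data.Nat.Primality using (Prime; prime⇒nonZero)
  open import Data.Integer hiding (suc; _^_; ∣_∣)
  open import Data.Integer.Properties using (pos-+)
  open import Data.Product using (_,_)
  open import Relation.Nullary using (¬_)
  open import Relation.Nullary.Decidable using (¬?)
  open import Relation.Binary.PropositionalEquality hiding ([_])
  open import Data.Integer.Tactic.RingSolver using (solve-∀)
  open FiniteSum
  open Congruence

  [_∣_] : ℕ → ℤ → ℕ
  [ m ∣ z ] = 𝟙 (+ m ∣? z)

  [_∤_] : ℕ → ℤ → ℕ
  [ m ∤ z ] = 𝟙 (¬? (+ m ∣? z))

  [∤]+[∣] : ∀ m z → [ m ∤ z ] ℕ.+ [ m ∣ z ] ≡ 1
  [∤]+[∣] m z = 𝟙-¬+𝟙 (+ m ∣? z) (¬? (+ m ∣? z))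

  [∣]-cong : ∀ {m} x y → + m ∣ (x - y) → [ m ∣ x ] ≡ [ m ∣ y ]
  [∣]-cong x y m∣x-y = 𝟙-cong (_ ∣? x) (_ ∣? y) (∣x-y∧∣x⇒∣y x y m∣x-y) (∣x-y∧∣x⇒∣y y x (∣x-y⇒∣y-x x y m∣x-y))

  [∤]-cong : ∀ {m} x y → + m ∣ (x - y) → [ m ∤ x ] ≡ [ m ∤ y ]
  [∤]-cong x y m∣x-y = 𝟙-cong (¬? (_ ∣? x)) (¬? (_ ∣? y))
    (λ m∤x m∣y → m∤x (∣x-y∧∣x⇒∣y y x (∣x-y⇒∣y-x x y m∣x-y) m∣y)) (λ m∤y m∣x → m∤y (∣x-y∧∣x⇒∣y x y m∣x-y m∣x))

  module _ {ℓ : ℕ} (pr : Prime ℓ) (j : ℕ) where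
    private
      M : ℕ
      M = ℓ ^ j
      instance
        M≢0 : ℕ.NonZero M
        M≢0 = ℕ.m^n≢0 ℓ j {{prime⇒nonZero pr}}

    -- A unit u makes c ↦ s + u c a bijection of ℤ/ℓ^j, so exactly one term survives.
    ∑-linear-congruence : ∀ s u → ¬ (+ ℓ ∣ u) → (g : ℕ → ℕ) (k : ℕ) →
                          (∀ c → + M ∣ (s + u * + c) → g c ≡ k) →
                          ∑[ c < M ] ([ M ∣ s + u * + c ] ℕ.* g c) ≡ k
    ∑-linear-congruence s u ℓ∤u g k g≡k
      with inverse-mod-prime-power pr u ℓ∤u j
    ... | u⁻¹ , M∣uu⁻¹-1 with representative M (- s * u⁻¹)
    ... | c₀ , c₀<M , M∣c₀+su⁻¹ = begin
      ∑[ c < M ] ([ M ∣ s + u * + c ] ℕ.* g c) ≡⟨ ∑-single M c₀ c₀<M others ⟩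
      [ M ∣ s + u * + c₀ ] ℕ.* g c₀           ≡⟨ cong₂ ℕ._*_ (𝟙-yes (_ ∣? _) solution) (g≡k c₀ solution) ⟩
      1 ℕ.* k                                  ≡⟨ ℕ.*-identityˡ k ⟩
      k                                        ∎
      where
      open ≡-Reasoning
      solution : + M ∣ (s + u * + c₀)
      solution = ∣-respʳ (expand s u u⁻¹ (+ c₀)) (∣m∣n⇒∣m+n (∣n⇒∣m*n u M∣c₀+su⁻¹) (∣m⇒∣-m (∣n⇒∣m*n s M∣uu⁻¹-1)))
        where
        expand : ∀ s u u⁻¹ c → u * (c - - s * u⁻¹) + - (s * (u * u⁻¹ - 1ℤ)) ≡ s + u * c
        expand = solve-∀
      others : ∀ i → i ℕ.< M → i ≢ c₀ → [ M ∣ s + u * + i ] ℕ.* g i ≡ 0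
      others i i<M i≢c₀ = 𝟙*-no (_ ∣? _) (g i) λ M∣s+ui →
        i≢c₀ (representative-unique i<M c₀<M (∣-respʳ (expand s u u⁻¹ (+ i) (+ c₀))
          (∣m∣n⇒∣m+n (∣n⇒∣m*n u⁻¹ (∣m∣n⇒∣m-n M∣s+ui solution)) (∣m⇒∣-m (∣n⇒∣m*n (+ i - + c₀) M∣uu⁻¹-1)))))
        where
        expand : ∀ s u u⁻¹ i c → u⁻¹ * ((s + u * i) - (s + u * c)) + - ((i - c) * (u * u⁻¹ - 1ℤ)) ≡ i - c
        expand = solve-∀

    count-linear-congruence : ∀ s u → ¬ (+ ℓ ∣ u) → ∑[ c < M ] [ M ∣ s + u * + c ] ≡ 1
    count-linear-congruence s u ℓ∤u =
      trans (∑-cong M (λ c → sym (ℕ.*-identityʳ _))) (∑-linear-congruence s u ℓ∤u (λ _ → 1) 1 (λ _ _ → refl))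

  count-prime-∣-linear : ∀ {ℓ} → Prime ℓ → ∀ j s u → ¬ (+ ℓ ∣ u) →
                         ∑[ x < ℓ ^ suc j ] [ ℓ ∣ s + u * + x ] ≡ ℓ ^ j
  count-prime-∣-linear {ℓ} pr j s u ℓ∤u = begin
    ∑[ x < ℓ ^ suc j ] [ ℓ ∣ s + u * + x ]       ≡⟨ cong (λ m → ∑[ x < m ] [ ℓ ∣ s + u * + x ]) (ℕ.*-comm ℓ (ℓ ^ j)) ⟩
    ∑[ x < ℓ ^ j ℕ.* ℓ ] [ ℓ ∣ s + u * + x ]     ≡⟨ ∑-periodic (ℓ ^ j) ℓ _ ℓ-periodic ⟩
    ℓ ^ j ℕ.* ∑[ x < ℓ ] [ ℓ ∣ s + u * + x ]     ≡⟨ cong (ℓ ^ j ℕ.*_) one-solution ⟩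
    ℓ ^ j ℕ.* 1                                  ≡⟨ ℕ.*-identityʳ _ ⟩
    ℓ ^ j                                        ∎
    where
    open ≡-Reasoning
    ℓ-periodic : ∀ i → [ ℓ ∣ s + u * + (ℓ ℕ.+ i) ] ≡ [ ℓ ∣ s + u * + i ]
    ℓ-periodic i = [∣]-cong _ _ (∣-respʳ (sym (trans (cong (λ z → s + u * z - (s + u * + i)) (pos-+ ℓ i)) (shift s u (+ ℓ) (+ i))))
                                         (∣n⇒∣m*n u ∣-refl))
      where
      shift : ∀ s u l i → s + u * (l + i) - (s + u * i) ≡ u * l
      shift = solve-∀
    one-solution : ∑[ x < ℓ ] [ ℓ ∣ s + u * + x ] ≡ 1
    one-solution = subst (λ m → ∑[ x < m ] [ m ∣ s + u * + x ] ≡ 1) (ℕ.*-identityʳ ℓ) (count-linear-congruence pr 1 s u ℓ∤u)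

module Decomposition where

  open import Data.Nat as ℕ using (ℕ; suc; _^_)
  import Data.Nat.Properties as ℕ
  open import Data.Nat.Primality using (Prime)
  open import Data.Integer hiding (suc; _^_; ∣_∣)
  open import Data.Integer.Properties using (pos-+; pos-*)
  open import Data.Product using (_,_)
  open import Data.Sum using (inj₁; inj₂; [_,_]′)
  open import Data.Empty using (⊥-elim)
  open import Relation.Nullary using (Dec; yes; no; ¬_)
  open import Relation.Nullary.Decidable using (¬?)
  open import Relation.Binary.PropositionalEquality hiding ([_])
  import Data.Integer.Tactic.RingSolver as ℤ
  import Data.Nat.Tactic.RingSolver as ℕ
  open FiniteSum
  open Congruence
  open LinearCongruence

  count-multiples : ∀ {ℓ} → Prime ℓ → ∀ j → ∑[ b < ℓ ^ suc j ] [ ℓ ∣ + b ] ≡ ℓ ^ j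
  count-multiples {ℓ} pr j =
    trans (∑-cong (ℓ ^ suc j) (λ b → cong [ ℓ ∣_] (shape (+ b)))) (count-prime-∣-linear pr j 0ℤ 1ℤ (prime∤1 pr))
    where
    shape : ∀ b → b ≡ 0ℤ + 1ℤ * b
    shape = ℤ.solve-∀

  count-units : ∀ {ℓ} → Prime ℓ → ∀ j → ∑[ b < ℓ ^ suc j ] [ ℓ ∤ + b ] ℕ.+ ℓ ^ j ≡ ℓ ^ suc j
  count-units {ℓ} pr j = begin
    ∑[ b < ℓ ^ suc j ] [ ℓ ∤ + b ] ℕ.+ ℓ ^ j                        ≡⟨ cong (∑[ b < ℓ ^ suc j ] [ ℓ ∤ + b ] ℕ.+_) (sym (count-multiples pr j)) ⟩
    ∑[ b < ℓ ^ suc j ] [ ℓ ∤ + b ] ℕ.+ ∑[ b < ℓ ^ suc j ] [ ℓ ∣ + b ] ≡⟨ sym (∑-distrib-+ (ℓ ^ suc j) _ _) ⟩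
    ∑[ b < ℓ ^ suc j ] ([ ℓ ∤ + b ] ℕ.+ [ ℓ ∣ + b ])                ≡⟨ ∑-cong (ℓ ^ suc j) (λ b → [∤]+[∣] ℓ (+ b)) ⟩
    ∑[ b < ℓ ^ suc j ] 1                                           ≡⟨ ∑-const (ℓ ^ suc j) 1 ⟩
    ℓ ^ suc j ℕ.* 1                                                ≡⟨ ℕ.*-identityʳ (ℓ ^ suc j) ⟩
    ℓ ^ suc j                                                      ∎
    where open ≡-Reasoning

  one : ℤ → ℕ
  one _ = 1

  one-cong : ∀ {ℓ} x y → + ℓ ∣ (x - y) → one x ≡ one y
  one-cong _ _ _ = refl

  -- σ = (a b ; c d) with entries in [0, ℓ^(j+1)) and X a = 1 − a: W counts the σ with det (I − σ) ≡ N,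
  -- each weighted by t (tr σ − 1).
  module Count {ℓ : ℕ} (pr : Prime ℓ) (j : ℕ) (N : ℤ) (t : ℤ → ℕ)
               (t-cong : ∀ x y → + ℓ ∣ (x - y) → t x ≡ t y) where

    M p : ℕ
    M = ℓ ^ suc j
    p = ℓ ^ j

    ℓ∣-of-M∣ : ∀ {z} → + M ∣ z → + ℓ ∣ z
    ℓ∣-of-M∣ = ∣-trans (ℓ∣ℓ^suc ℓ j)

    X : ℕ → ℤ
    X a = 1ℤ - + a

    Δ : ℕ → ℕ → ℕ → ℕ → ℤ
    Δ a b c d = defect N (+ a) (+ b) (+ c) (+ d)

    tr-1 : ℕ → ℕ → ℤ
    tr-1 a d = + a + + d - 1ℤ

    F : ℕ → ℕ → ℕ → ℕ → ℕ
    F a b c d = [ M ∣ Δ a b c d ] ℕ.* t (tr-1 a d)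

    Fᵇ Fᶜ Fᵃ Fᵈ F⁰ : ℕ → ℕ → ℕ → ℕ → ℕ
    Fᵇ a b c d = [ ℓ ∤ + b ] ℕ.* F a b c d
    Fᶜ a b c d = [ ℓ ∣ + b ] ℕ.* ([ ℓ ∤ + c ] ℕ.* F a b c d)
    Fᵃ a b c d = [ ℓ ∣ + b ] ℕ.* ([ ℓ ∣ + c ] ℕ.* ([ ℓ ∤ X a ] ℕ.* F a b c d))
    Fᵈ a b c d = [ ℓ ∣ + b ] ℕ.* ([ ℓ ∣ + c ] ℕ.* ([ ℓ ∣ X a ] ℕ.* ([ ℓ ∤ X d ] ℕ.* F a b c d)))
    F⁰ a b c d = [ ℓ ∣ + b ] ℕ.* ([ ℓ ∣ + c ] ℕ.* ([ ℓ ∣ X a ] ℕ.* ([ ℓ ∣ X d ] ℕ.* [ M ∣ Δ a b c d ])))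

    W Wᵇ Wᶜ Wᵃ Wᵈ W⁰ : ℕ
    W  = ∑⁴ M F
    Wᵇ = ∑⁴ M Fᵇ
    Wᶜ = ∑⁴ M Fᶜ
    Wᵃ = ∑⁴ M Fᵃ
    Wᵈ = ∑⁴ M Fᵈ
    W⁰ = ∑⁴ M F⁰

    φ τ ω : ℕ
    φ = ∑[ b < M ] [ ℓ ∤ + b ]
    τ = ∑[ x < M ] t (+ x)
    ω = ∑[ a < M ] ([ ℓ ∤ X a ] ℕ.* t (+ a))

    -- Classify σ by the first entry of I − σ, in the order b, c, 1 − a, 1 − d, that is a unit mod ℓ;
    -- if none is, tr σ ≡ 2 (mod ℓ) and the weight is t 1.
    F-split : ∀ a b c d → F a b c d ≡ Fᵇ a b c d ℕ.+ Fᶜ a b c d ℕ.+ Fᵃ a b c d ℕ.+ Fᵈ a b c d ℕ.+ t 1ℤ ℕ.* F⁰ a b c d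
    F-split a b c d = begin
      F a b c d                                     ≡⟨ sym (ℕ.*-identityˡ _) ⟩
      1 ℕ.* F a b c d                               ≡⟨ cong (ℕ._* F a b c d) (sym (partition (+ b) (+ c) (X a) (X d))) ⟩
      (u₁ ℕ.+ d₁ ℕ.* (u₂ ℕ.+ d₂ ℕ.* (u₃ ℕ.+ d₃ ℕ.* (u₄ ℕ.+ d₄)))) ℕ.* F a b c d
                                                    ≡⟨ distribute u₁ d₁ u₂ d₂ u₃ d₃ u₄ d₄ m w ⟩
      S ℕ.+ d₁ ℕ.* (d₂ ℕ.* (d₃ ℕ.* (d₄ ℕ.* w) ℕ.* m)) ≡⟨ cong (λ z → S ℕ.+ d₁ ℕ.* (d₂ ℕ.* (z ℕ.* m))) trace≡1 ⟩
      S ℕ.+ d₁ ℕ.* (d₂ ℕ.* (d₃ ℕ.* (d₄ ℕ.* t 1ℤ) ℕ.* m)) ≡⟨ cong (S ℕ.+_) (regroup d₁ d₂ d₃ d₄ m (t 1ℤ)) ⟩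
      S ℕ.+ t 1ℤ ℕ.* F⁰ a b c d                     ∎
      where
      open ≡-Reasoning
      u₁ d₁ u₂ d₂ u₃ d₃ u₄ d₄ m w S : ℕ
      u₁ = [ ℓ ∤ + b ]
      d₁ = [ ℓ ∣ + b ]
      u₂ = [ ℓ ∤ + c ]
      d₂ = [ ℓ ∣ + c ]
      u₃ = [ ℓ ∤ X a ]
      d₃ = [ ℓ ∣ X a ]
      u₄ = [ ℓ ∤ X d ]
      d₄ = [ ℓ ∣ X d ]
      m = [ M ∣ Δ a b c d ]
      w = t (tr-1 a d)
      S = Fᵇ a b c d ℕ.+ Fᶜ a b c d ℕ.+ Fᵃ a b c d ℕ.+ Fᵈ a b c d
      partition : ∀ b c x y → [ ℓ ∤ b ] ℕ.+ [ ℓ ∣ b ] ℕ.* ([ ℓ ∤ c ] ℕ.+ [ ℓ ∣ c ] ℕ.* ([ ℓ ∤ x ] ℕ.+ [ ℓ ∣ x ] ℕ.* ([ ℓ ∤ y ] ℕ.+ [ ℓ ∣ y ]))) ≡ 1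
      partition b c x y
        rewrite [∤]+[∣] ℓ y | ℕ.*-identityʳ [ ℓ ∣ x ] | [∤]+[∣] ℓ x | ℕ.*-identityʳ [ ℓ ∣ c ]
              | [∤]+[∣] ℓ c | ℕ.*-identityʳ [ ℓ ∣ b ] = [∤]+[∣] ℓ b
      distribute : ∀ u₁ d₁ u₂ d₂ u₃ d₃ u₄ d₄ m w →
        (u₁ ℕ.+ d₁ ℕ.* (u₂ ℕ.+ d₂ ℕ.* (u₃ ℕ.+ d₃ ℕ.* (u₄ ℕ.+ d₄)))) ℕ.* (m ℕ.* w) ≡
        u₁ ℕ.* (m ℕ.* w) ℕ.+ d₁ ℕ.* (u₂ ℕ.* (m ℕ.* w)) ℕ.+ d₁ ℕ.* (d₂ ℕ.* (u₃ ℕ.* (m ℕ.* w)))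
          ℕ.+ d₁ ℕ.* (d₂ ℕ.* (d₃ ℕ.* (u₄ ℕ.* (m ℕ.* w)))) ℕ.+ d₁ ℕ.* (d₂ ℕ.* (d₃ ℕ.* (d₄ ℕ.* w) ℕ.* m))
      distribute = ℕ.solve-∀
      regroup : ∀ d₁ d₂ d₃ d₄ m w → d₁ ℕ.* (d₂ ℕ.* (d₃ ℕ.* (d₄ ℕ.* w) ℕ.* m)) ≡ w ℕ.* (d₁ ℕ.* (d₂ ℕ.* (d₃ ℕ.* (d₄ ℕ.* m))))
      regroup = ℕ.solve-∀
      shift : ∀ a d → (a + d - 1ℤ) - 1ℤ ≡ - ((1ℤ - a) + (1ℤ - d))
      shift = ℤ.solve-∀
      trace≡1 : d₃ ℕ.* (d₄ ℕ.* w) ≡ d₃ ℕ.* (d₄ ℕ.* t 1ℤ)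
      trace≡1 = 𝟙*-cong (_ ∣? _) λ ℓ∣Xa → 𝟙*-cong (_ ∣? _) λ ℓ∣Xd →
        t-cong _ _ (∣-respʳ (sym (shift (+ a) (+ d))) (∣m⇒∣-m (∣m∣n⇒∣m+n ℓ∣Xa ℓ∣Xd)))

    W-split : W ≡ Wᵇ ℕ.+ Wᶜ ℕ.+ Wᵃ ℕ.+ Wᵈ ℕ.+ t 1ℤ ℕ.* W⁰
    W-split = begin
      W                                                                   ≡⟨ ∑⁴-cong M F-split ⟩
      ∑⁴ M (λ a b c d → Fᵇ a b c d ℕ.+ Fᶜ a b c d ℕ.+ Fᵃ a b c d ℕ.+ Fᵈ a b c d ℕ.+ t 1ℤ ℕ.* F⁰ a b c d)
        ≡⟨ ∑⁴-distrib-+ M _ _ ⟩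
      ∑⁴ M (λ a b c d → Fᵇ a b c d ℕ.+ Fᶜ a b c d ℕ.+ Fᵃ a b c d ℕ.+ Fᵈ a b c d) ℕ.+ ∑⁴ M (λ a b c d → t 1ℤ ℕ.* F⁰ a b c d)
        ≡⟨ cong₂ ℕ._+_ (trans (∑⁴-distrib-+ M _ _) (cong (ℕ._+ Wᵈ) (trans (∑⁴-distrib-+ M _ _) (cong (ℕ._+ Wᵃ) (∑⁴-distrib-+ M _ _)))))
                       (*-distribˡ-∑⁴ M (t 1ℤ) F⁰) ⟩
      Wᵇ ℕ.+ Wᶜ ℕ.+ Wᵃ ℕ.+ Wᵈ ℕ.+ t 1ℤ ℕ.* W⁰                            ∎
      where open ≡-Reasoning

    count-X : ∑[ a < M ] [ ℓ ∣ X a ] ≡ p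
    count-X = trans (∑-cong M (λ a → cong [ ℓ ∣_] (shape (+ a)))) (count-prime-∣-linear pr j 1ℤ -1ℤ (∤-neg 1ℤ (prime∤1 pr)))
      where
      shape : ∀ a → 1ℤ - a ≡ 1ℤ + -1ℤ * a
      shape = ℤ.solve-∀

    row-τ : ∀ a → ∑[ d < M ] t (tr-1 a d) ≡ τ
    row-τ a = begin
      ∑[ d < M ] t (tr-1 a d)       ≡⟨ ∑-cong M (λ d → cong (λ z → t (z - 1ℤ)) (sym (pos-+ a d))) ⟩
      ∑[ d < M ] h (a ℕ.+ d)        ≡⟨ ∑-translate M a h h-periodic ⟩
      ∑ M h                         ≡⟨ sym (∑-translate M 1 h h-periodic) ⟩
      ∑[ d < M ] h (1 ℕ.+ d)        ≡⟨ ∑-cong M (λ d → cong t (cancel (+ d))) ⟩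
      τ                             ∎
      where
      open ≡-Reasoning
      h : ℕ → ℕ
      h n = t (+ n - 1ℤ)
      h-periodic : ∀ i → h (M ℕ.+ i) ≡ h i
      h-periodic i = t-cong _ _ (∣-respʳ (sym (trans (cong (λ z → z - 1ℤ - (+ i - 1ℤ)) (pos-+ M i)) (shift (+ M) (+ i))))
                                         (ℓ∣ℓ^suc ℓ j))
        where
        shift : ∀ m i → m + i - 1ℤ - (i - 1ℤ) ≡ m
        shift = ℤ.solve-∀
      cancel : ∀ d → + 1 + d - 1ℤ ≡ d
      cancel = ℤ.solve-∀

    ∑-guarded : ∀ {q} {Q : Set q} (Q? : Dec Q) (G : ℕ → ℕ) k → (Q → ∑ M G ≡ k) →
                ∑[ c < M ] (𝟙 Q? ℕ.* G c) ≡ 𝟙 Q? ℕ.* k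
    ∑-guarded Q? G k ∑G≡k = trans (*-distribˡ-∑ M (𝟙 Q?) G) (𝟙*-cong Q? ∑G≡k)

    ∑-solve : ∀ (z : ℕ → ℤ) s u → ¬ (+ ℓ ∣ u) → (∀ c → z c ≡ s + u * + c) → (g : ℕ → ℕ) (k : ℕ) →
              (∀ c → + M ∣ z c → g c ≡ k) → ∑[ c < M ] ([ M ∣ z c ] ℕ.* g c) ≡ k
    ∑-solve z s u ℓ∤u z≡ g k g≡k =
      trans (∑-cong M (λ c → cong (λ y → [ M ∣ y ] ℕ.* g c) (z≡ c)))
            (∑-linear-congruence pr (suc j) s u ℓ∤u g k (λ c M∣ → g≡k c (∣-respʳ (sym (z≡ c)) M∣)))

    Δ-linear-in-c : ∀ a b d c → Δ a b c d ≡ (X a * X d - N) + (- + b) * + c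
    Δ-linear-in-c a b d c = shape (X a) (X d) (+ b) (+ c) N
      where
      shape : ∀ x y b c n → x * y - b * c - n ≡ (x * y - n) + (- b) * c
      shape = ℤ.solve-∀

    Δ-linear-in-b : ∀ a c d b → Δ a b c d ≡ (X a * X d - N) + (- + c) * + b
    Δ-linear-in-b a c d b = shape (X a) (X d) (+ b) (+ c) N
      where
      shape : ∀ x y b c n → x * y - b * c - n ≡ (x * y - n) + (- c) * b
      shape = ℤ.solve-∀

    Δ-linear-in-d : ∀ a b c d → Δ a b c d ≡ (X a - + b * + c - N) + (- X a) * + d
    Δ-linear-in-d a b c d = shape (X a) (+ d) (+ b) (+ c) N
      where
      shape : ∀ x d b c n → x * (1ℤ - d) - b * c - n ≡ (x - b * c - n) + (- x) * d
      shape = ℤ.solve-∀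

    Δ-linear-in-a : ∀ b c d a → Δ a b c d ≡ (X d - + b * + c - N) + (- X d) * + a
    Δ-linear-in-a b c d a = shape (+ a) (X d) (+ b) (+ c) N
      where
      shape : ∀ a y b c n → (1ℤ - a) * y - b * c - n ≡ (y - b * c - n) + (- y) * a
      shape = ℤ.solve-∀

    ∑c-Fᵇ : ∀ a b d → ∑[ c < M ] Fᵇ a b c d ≡ [ ℓ ∤ + b ] ℕ.* t (tr-1 a d)
    ∑c-Fᵇ a b d = ∑-guarded (¬? (+ ℓ ∣? + b)) (λ c → F a b c d) (t (tr-1 a d)) λ ℓ∤b →
      ∑-solve (λ c → Δ a b c d) (X a * X d - N) (- + b) (∤-neg (+ b) ℓ∤b) (Δ-linear-in-c a b d) _ _ (λ _ _ → refl)

    Wᵇ≡ : Wᵇ ≡ φ ℕ.* (M ℕ.* τ)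
    Wᵇ≡ = begin
      Wᵇ                                          ≡⟨ ∑-cong M (λ a → ∑-cong M (inner a)) ⟩
      ∑[ a < M ] ∑[ b < M ] ([ ℓ ∤ + b ] ℕ.* τ)   ≡⟨ ∑-cong M (λ _ → *-distribʳ-∑ M τ _) ⟩
      ∑[ a < M ] (φ ℕ.* τ)                        ≡⟨ ∑-const M _ ⟩
      M ℕ.* (φ ℕ.* τ)                             ≡⟨ swap M φ τ ⟩
      φ ℕ.* (M ℕ.* τ)                             ∎
      where
      open ≡-Reasoning
      swap : ∀ x y z → x ℕ.* (y ℕ.* z) ≡ y ℕ.* (x ℕ.* z)
      swap = ℕ.solve-∀
      inner : ∀ a b → ∑[ c < M ] ∑[ d < M ] Fᵇ a b c d ≡ [ ℓ ∤ + b ] ℕ.* τ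
      inner a b = begin
        ∑[ c < M ] ∑[ d < M ] Fᵇ a b c d          ≡⟨ ∑-comm M M _ ⟩
        ∑[ d < M ] ∑[ c < M ] Fᵇ a b c d          ≡⟨ ∑-cong M (∑c-Fᵇ a b) ⟩
        ∑[ d < M ] ([ ℓ ∤ + b ] ℕ.* t (tr-1 a d)) ≡⟨ *-distribˡ-∑ M [ ℓ ∤ + b ] (λ d → t (tr-1 a d)) ⟩
        [ ℓ ∤ + b ] ℕ.* ∑[ d < M ] t (tr-1 a d)   ≡⟨ cong ([ ℓ ∤ + b ] ℕ.*_) (row-τ a) ⟩
        [ ℓ ∤ + b ] ℕ.* τ                         ∎

    row : ℕ → ℕ
    row a = ∑[ d < M ] (t (tr-1 a d) ℕ.* [ ℓ ∣ X a * X d - N ])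

    -- b is determined by the other entries, and c being a unit ties ℓ ∣ b to ℓ ∣ (1 − a)(1 − d) − N.
    ∑b-Fᶜ : ∀ a c d → ∑[ b < M ] Fᶜ a b c d ≡ [ ℓ ∤ + c ] ℕ.* (t (tr-1 a d) ℕ.* [ ℓ ∣ X a * X d - N ])
    ∑b-Fᶜ a c d = begin
      ∑[ b < M ] Fᶜ a b c d
        ≡⟨ ∑-cong M (λ b → rearrange [ ℓ ∣ + b ] [ ℓ ∤ + c ] [ M ∣ Δ a b c d ] (t (tr-1 a d))) ⟩
      ∑[ b < M ] ([ ℓ ∤ + c ] ℕ.* ([ M ∣ Δ a b c d ] ℕ.* (t (tr-1 a d) ℕ.* [ ℓ ∣ + b ])))
        ≡⟨ ∑-guarded (¬? (_ ∣? _)) _ _ (λ ℓ∤c →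
             ∑-solve (λ b → Δ a b c d) s (- + c) (∤-neg (+ c) ℓ∤c) (Δ-linear-in-b a c d) _ _
               (λ b M∣Δ → cong (t (tr-1 a d) ℕ.*_) (same-class ℓ∤c b (∣-respʳ (Δ-linear-in-b a c d b) M∣Δ)))) ⟩
      [ ℓ ∤ + c ] ℕ.* (t (tr-1 a d) ℕ.* [ ℓ ∣ s ])  ∎
      where
      open ≡-Reasoning
      s : ℤ
      s = X a * X d - N
      rearrange : ∀ d₁ u m w → d₁ ℕ.* (u ℕ.* (m ℕ.* w)) ≡ u ℕ.* (m ℕ.* (w ℕ.* d₁))
      rearrange = ℕ.solve-∀
      cancel : ∀ s c b → s + - c * b + c * b ≡ s
      cancel = ℤ.solve-∀
      cancel′ : ∀ s y → s + y - s ≡ y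
      cancel′ = ℤ.solve-∀
      same-class : ¬ (+ ℓ ∣ + c) → ∀ b → + M ∣ (s + (- + c) * + b) → [ ℓ ∣ + b ] ≡ [ ℓ ∣ s ]
      same-class ℓ∤c b M∣ = 𝟙-cong (_ ∣? _) (_ ∣? _)
        (λ ℓ∣b → ∣-respʳ (cancel s (+ c) (+ b)) (∣m∣n⇒∣m+n (ℓ∣-of-M∣ M∣) (∣n⇒∣m*n (+ c) ℓ∣b)))
        (λ ℓ∣s → [ (λ ℓ∣-c → ⊥-elim (∤-neg (+ c) ℓ∤c ℓ∣-c)) , (λ ℓ∣b → ℓ∣b) ]′
                   (euclidsLemmaℤ pr (- + c) (+ b) (∣-respʳ (cancel′ s (- + c * + b)) (∣m∣n⇒∣m-n (ℓ∣-of-M∣ M∣) ℓ∣s))))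

    Wᶜ≡ : Wᶜ ≡ φ ℕ.* ∑ M row
    Wᶜ≡ = trans (∑-cong M per-a) (*-distribˡ-∑ M φ row)
      where
      open ≡-Reasoning
      per-a : ∀ a → ∑[ b < M ] ∑[ c < M ] ∑[ d < M ] Fᶜ a b c d ≡ φ ℕ.* row a
      per-a a = begin
        ∑[ b < M ] ∑[ c < M ] ∑[ d < M ] Fᶜ a b c d  ≡⟨ ∑-comm M M _ ⟩
        ∑[ c < M ] ∑[ b < M ] ∑[ d < M ] Fᶜ a b c d  ≡⟨ ∑-cong M (λ c → ∑-comm M M _) ⟩
        ∑[ c < M ] ∑[ d < M ] ∑[ b < M ] Fᶜ a b c d  ≡⟨ ∑-cong M (λ c → ∑-cong M (∑b-Fᶜ a c)) ⟩
        ∑[ c < M ] ∑[ d < M ] ([ ℓ ∤ + c ] ℕ.* (t (tr-1 a d) ℕ.* [ ℓ ∣ X a * X d - N ]))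
          ≡⟨ ∑-cong M (λ c → *-distribˡ-∑ M [ ℓ ∤ + c ] _) ⟩
        ∑[ c < M ] ([ ℓ ∤ + c ] ℕ.* row a)           ≡⟨ *-distribʳ-∑ M (row a) _ ⟩
        φ ℕ.* row a                                   ∎

    ∑-multiples² : ∀ k → ∑[ b < M ] ∑[ c < M ] ([ ℓ ∣ + b ] ℕ.* ([ ℓ ∣ + c ] ℕ.* k)) ≡ p ℕ.* (p ℕ.* k)
    ∑-multiples² k = begin
      ∑[ b < M ] ∑[ c < M ] ([ ℓ ∣ + b ] ℕ.* ([ ℓ ∣ + c ] ℕ.* k))  ≡⟨ ∑-cong M (λ b → *-distribˡ-∑ M [ ℓ ∣ + b ] _) ⟩
      ∑[ b < M ] ([ ℓ ∣ + b ] ℕ.* ∑[ c < M ] ([ ℓ ∣ + c ] ℕ.* k))  ≡⟨ ∑-cong M (λ b → cong ([ ℓ ∣ + b ] ℕ.*_) (*-distribʳ-∑ M k _)) ⟩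
      ∑[ b < M ] ([ ℓ ∣ + b ] ℕ.* (ν ℕ.* k))                       ≡⟨ *-distribʳ-∑ M _ _ ⟩
      ν ℕ.* (ν ℕ.* k)                                              ≡⟨ cong (λ z → z ℕ.* (z ℕ.* k)) (count-multiples pr j) ⟩
      p ℕ.* (p ℕ.* k)                                              ∎
      where
      open ≡-Reasoning
      ν : ℕ
      ν = ∑[ b < M ] [ ℓ ∣ + b ]

    TraceByA TraceByD : Set
    TraceByA = ∀ a b c d → + ℓ ∣ + b → + ℓ ∣ + c → ¬ (+ ℓ ∣ X a) → + M ∣ Δ a b c d → t (tr-1 a d) ≡ t (+ a)
    TraceByD = ∀ a b c d → + ℓ ∣ + b → + ℓ ∣ + c → ¬ (+ ℓ ∣ X d) → + M ∣ Δ a b c d → [ ℓ ∣ X a ] ℕ.* t (tr-1 a d) ≡ t (+ d)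

    ∑d-Fᵃ : TraceByA → ∀ a b c → ∑[ d < M ] Fᵃ a b c d ≡ [ ℓ ∣ + b ] ℕ.* ([ ℓ ∣ + c ] ℕ.* ([ ℓ ∤ X a ] ℕ.* t (+ a)))
    ∑d-Fᵃ trace≡a a b c =
      ∑-guarded (+ ℓ ∣? + b) (λ d → [ ℓ ∣ + c ] ℕ.* ([ ℓ ∤ X a ] ℕ.* F a b c d)) _ λ ℓ∣b →
        trans (*-distribˡ-∑ M [ ℓ ∣ + c ] (λ d → [ ℓ ∤ X a ] ℕ.* F a b c d)) (𝟙*-cong (+ ℓ ∣? + c) λ ℓ∣c →
          ∑-guarded (¬? (+ ℓ ∣? X a)) (λ d → F a b c d) (t (+ a)) λ ℓ∤Xa →
            ∑-solve (λ d → Δ a b c d) (X a - + b * + c - N) (- X a) (∤-neg (X a) ℓ∤Xa) (Δ-linear-in-d a b c)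
                    (λ d → t (tr-1 a d)) (t (+ a)) (λ d → trace≡a a b c d ℓ∣b ℓ∣c ℓ∤Xa))

    Wᵃ≡ : TraceByA → Wᵃ ≡ p ℕ.* (p ℕ.* ω)
    Wᵃ≡ trace≡a = begin
      Wᵃ                                                          ≡⟨ ∑-cong M (λ a → ∑-cong M (λ b → ∑-cong M (∑d-Fᵃ trace≡a a b))) ⟩
      ∑[ a < M ] ∑[ b < M ] ∑[ c < M ] ([ ℓ ∣ + b ] ℕ.* ([ ℓ ∣ + c ] ℕ.* K a)) ≡⟨ ∑-cong M (λ a → ∑-multiples² (K a)) ⟩
      ∑[ a < M ] (p ℕ.* (p ℕ.* K a))                              ≡⟨ *-distribˡ-∑ M p _ ⟩
      p ℕ.* ∑[ a < M ] (p ℕ.* K a)                                ≡⟨ cong (p ℕ.*_) (*-distribˡ-∑ M p K) ⟩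
      p ℕ.* (p ℕ.* ω)                                             ∎
      where
      open ≡-Reasoning
      K : ℕ → ℕ
      K a = [ ℓ ∤ X a ] ℕ.* t (+ a)

    ∑a-Fᵈ : TraceByD → ∀ b c d → ∑[ a < M ] Fᵈ a b c d ≡ [ ℓ ∣ + b ] ℕ.* ([ ℓ ∣ + c ] ℕ.* ([ ℓ ∤ X d ] ℕ.* t (+ d)))
    ∑a-Fᵈ trace≡d b c d =
      trans (∑-cong M (λ a → rearrange [ ℓ ∣ + b ] [ ℓ ∣ + c ] [ ℓ ∣ X a ] [ ℓ ∤ X d ] [ M ∣ Δ a b c d ] (t (tr-1 a d))))
        (∑-guarded (+ ℓ ∣? + b) (λ a → [ ℓ ∣ + c ] ℕ.* ([ ℓ ∤ X d ] ℕ.* G a)) _ λ ℓ∣b →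
          trans (*-distribˡ-∑ M [ ℓ ∣ + c ] (λ a → [ ℓ ∤ X d ] ℕ.* G a)) (𝟙*-cong (+ ℓ ∣? + c) λ ℓ∣c →
            ∑-guarded (¬? (+ ℓ ∣? X d)) G (t (+ d)) λ ℓ∤Xd →
              ∑-solve (λ a → Δ a b c d) (X d - + b * + c - N) (- X d) (∤-neg (X d) ℓ∤Xd) (Δ-linear-in-a b c d)
                      (λ a → [ ℓ ∣ X a ] ℕ.* t (tr-1 a d)) (t (+ d)) (λ a → trace≡d a b c d ℓ∣b ℓ∣c ℓ∤Xd)))
      where
      rearrange : ∀ b c x u m w → b ℕ.* (c ℕ.* (x ℕ.* (u ℕ.* (m ℕ.* w)))) ≡ b ℕ.* (c ℕ.* (u ℕ.* (m ℕ.* (x ℕ.* w))))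
      rearrange = ℕ.solve-∀
      G : ℕ → ℕ
      G a = [ M ∣ Δ a b c d ] ℕ.* ([ ℓ ∣ X a ] ℕ.* t (tr-1 a d))

    Wᵈ≡ : TraceByD → Wᵈ ≡ p ℕ.* (p ℕ.* ω)
    Wᵈ≡ trace≡d = begin
      Wᵈ                                                            ≡⟨ ∑-comm M M _ ⟩
      ∑[ b < M ] ∑[ a < M ] ∑[ c < M ] ∑[ d < M ] Fᵈ a b c d        ≡⟨ ∑-cong M (λ b → ∑-comm M M _) ⟩
      ∑[ b < M ] ∑[ c < M ] ∑[ a < M ] ∑[ d < M ] Fᵈ a b c d        ≡⟨ ∑-cong M (λ b → ∑-cong M (λ c → ∑-comm M M _)) ⟩
      ∑[ b < M ] ∑[ c < M ] ∑[ d < M ] ∑[ a < M ] Fᵈ a b c d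
        ≡⟨ ∑-cong M (λ b → ∑-cong M (λ c → trans (∑-cong M (∑a-Fᵈ trace≡d b c)) (*-distribˡ-∑ M [ ℓ ∣ + b ] _))) ⟩
      ∑[ b < M ] ∑[ c < M ] ([ ℓ ∣ + b ] ℕ.* ∑[ d < M ] ([ ℓ ∣ + c ] ℕ.* ([ ℓ ∤ X d ] ℕ.* t (+ d))))
        ≡⟨ ∑-cong M (λ b → ∑-cong M (λ c → cong ([ ℓ ∣ + b ] ℕ.*_) (*-distribˡ-∑ M [ ℓ ∣ + c ] _))) ⟩
      ∑[ b < M ] ∑[ c < M ] ([ ℓ ∣ + b ] ℕ.* ([ ℓ ∣ + c ] ℕ.* ω))    ≡⟨ ∑-multiples² ω ⟩
      p ℕ.* (p ℕ.* ω)                                               ∎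
      where open ≡-Reasoning

    ℓ∣N-of-solution : ∀ a b c d → + ℓ ∣ + b → + ℓ ∣ X a → + M ∣ Δ a b c d → + ℓ ∣ N
    ℓ∣N-of-solution a b c d ℓ∣b ℓ∣Xa M∣Δ =
      ∣-respʳ (cancel (X a * X d) (+ b * + c) N)
              (∣m∣n⇒∣m-n (∣m∣n⇒∣m-n (∣m⇒∣m*n (X d) ℓ∣Xa) (∣m⇒∣m*n (+ c) ℓ∣b)) (ℓ∣-of-M∣ M∣Δ))
      where
      cancel : ∀ x y n → x - y - (x - y - n) ≡ n
      cancel = ℤ.solve-∀

    no-solution : ¬ (+ ℓ ∣ N) → ∀ a b c d → [ ℓ ∣ + b ] ℕ.* ([ ℓ ∣ X a ] ℕ.* [ M ∣ Δ a b c d ]) ≡ 0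
    no-solution ℓ∤N a b c d with + ℓ ∣? + b | + ℓ ∣? X a | + M ∣? Δ a b c d
    ... | no _    | _        | _       = refl
    ... | yes _   | no _     | _       = refl
    ... | yes _   | yes _    | no _    = refl
    ... | yes ℓ∣b | yes ℓ∣Xa | yes M∣Δ = ⊥-elim (ℓ∤N (ℓ∣N-of-solution a b c d ℓ∣b ℓ∣Xa M∣Δ))

    Wᵈ≡0 : ¬ (+ ℓ ∣ N) → Wᵈ ≡ 0
    Wᵈ≡0 ℓ∤N = ∑⁴-zero M λ a b c d →
      trans (regroup [ ℓ ∣ + b ] [ ℓ ∣ + c ] [ ℓ ∣ X a ] [ ℓ ∤ X d ] [ M ∣ Δ a b c d ] (t (tr-1 a d)))
            (cong (ℕ._* ([ ℓ ∣ + c ] ℕ.* ([ ℓ ∤ X d ] ℕ.* t (tr-1 a d)))) (no-solution ℓ∤N a b c d))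
      where
      regroup : ∀ b c x y m w → b ℕ.* (c ℕ.* (x ℕ.* (y ℕ.* (m ℕ.* w)))) ≡ b ℕ.* (x ℕ.* m) ℕ.* (c ℕ.* (y ℕ.* w))
      regroup = ℕ.solve-∀

    W⁰≡0-ℓ∤N : ¬ (+ ℓ ∣ N) → W⁰ ≡ 0
    W⁰≡0-ℓ∤N ℓ∤N = ∑⁴-zero M λ a b c d →
      trans (regroup [ ℓ ∣ + b ] [ ℓ ∣ + c ] [ ℓ ∣ X a ] [ ℓ ∣ X d ] [ M ∣ Δ a b c d ])
            (cong (ℕ._* ([ ℓ ∣ + c ] ℕ.* [ ℓ ∣ X d ])) (no-solution ℓ∤N a b c d))
      where
      regroup : ∀ b c x y m → b ℕ.* (c ℕ.* (x ℕ.* (y ℕ.* m))) ≡ b ℕ.* (x ℕ.* m) ℕ.* (c ℕ.* y)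
      regroup = ℕ.solve-∀

    W⁰≡0-ℓ²∤N : + (ℓ ℕ.* ℓ) ∣ + M → ¬ (+ (ℓ ℕ.* ℓ) ∣ N) → W⁰ ≡ 0
    W⁰≡0-ℓ²∤N ℓ²∣M ℓ²∤N = ∑⁴-zero M term≡0
      where
      ℓ∣x∧ℓ∣y⇒ℓ²∣xy : ∀ {x y} → + ℓ ∣ x → + ℓ ∣ y → + (ℓ ℕ.* ℓ) ∣ (x * y)
      ℓ∣x∧ℓ∣y⇒ℓ²∣xy {x} {y} ℓ∣x ℓ∣y = subst (_∣ (x * y)) (sym (pos-* ℓ ℓ)) (∣-trans (*-monoˡ-∣ (+ ℓ) ℓ∣x) (*-monoʳ-∣ x ℓ∣y))
      cancel : ∀ x y n → x - y - (x - y - n) ≡ n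
      cancel = ℤ.solve-∀
      term≡0 : ∀ a b c d → [ ℓ ∣ + b ] ℕ.* ([ ℓ ∣ + c ] ℕ.* ([ ℓ ∣ X a ] ℕ.* ([ ℓ ∣ X d ] ℕ.* [ M ∣ Δ a b c d ]))) ≡ 0
      term≡0 a b c d with + ℓ ∣? + b | + ℓ ∣? + c | + ℓ ∣? X a | + ℓ ∣? X d | + M ∣? Δ a b c d
      ... | no _    | _       | _        | _        | _       = refl
      ... | yes _   | no _    | _        | _        | _       = refl
      ... | yes _   | yes _   | no _     | _        | _       = refl
      ... | yes _   | yes _   | yes _    | no _     | _       = refl
      ... | yes _   | yes _   | yes _    | yes _    | no _    = refl
      ... | yes ℓ∣b | yes ℓ∣c | yes ℓ∣Xa | yes ℓ∣Xd | yes M∣Δ =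
        ⊥-elim (ℓ²∤N (∣-respʳ (cancel (X a * X d) (+ b * + c) N)
          (∣m∣n⇒∣m-n (∣m∣n⇒∣m-n (ℓ∣x∧ℓ∣y⇒ℓ²∣xy ℓ∣Xa ℓ∣Xd) (ℓ∣x∧ℓ∣y⇒ℓ²∣xy ℓ∣b ℓ∣c)) (∣-trans ℓ²∣M M∣Δ))))

    row-ℓ∣X : + ℓ ∣ N → ∀ a → + ℓ ∣ X a → row a ≡ τ
    row-ℓ∣X ℓ∣N a ℓ∣Xa =
      trans (∑-cong M (λ d → trans (cong (t (tr-1 a d) ℕ.*_) (𝟙-yes (_ ∣? _) (∣m∣n⇒∣m-n (∣m⇒∣m*n (X d) ℓ∣Xa) ℓ∣N)))
                                   (ℕ.*-identityʳ _)))
            (row-τ a)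

    row-ℓ∤X : + ℓ ∣ N → ∀ a → ¬ (+ ℓ ∣ X a) → row a ≡ t (+ a) ℕ.* p
    row-ℓ∤X ℓ∣N a ℓ∤Xa = begin
      row a                                   ≡⟨ ∑-cong M term ⟩
      ∑[ d < M ] (t (+ a) ℕ.* [ ℓ ∣ X d ])    ≡⟨ *-distribˡ-∑ M (t (+ a)) _ ⟩
      t (+ a) ℕ.* ∑[ d < M ] [ ℓ ∣ X d ]      ≡⟨ cong (t (+ a) ℕ.*_) count-X ⟩
      t (+ a) ℕ.* p                           ∎
      where
      open ≡-Reasoning
      add-N : ∀ z n → z - n + n ≡ z
      add-N = ℤ.solve-∀
      shift : ∀ a d → a + d - 1ℤ - a ≡ - (1ℤ - d)
      shift = ℤ.solve-∀
      ℓ∣X⇔ : ∀ d → [ ℓ ∣ X a * X d - N ] ≡ [ ℓ ∣ X d ]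
      ℓ∣X⇔ d = 𝟙-cong (_ ∣? _) (_ ∣? _)
        (λ ℓ∣ → [ (λ ℓ∣Xa → ⊥-elim (ℓ∤Xa ℓ∣Xa)) , (λ ℓ∣Xd → ℓ∣Xd) ]′
                  (euclidsLemmaℤ pr (X a) (X d) (∣-respʳ (add-N _ N) (∣m∣n⇒∣m+n ℓ∣ ℓ∣N))))
        (λ ℓ∣Xd → ∣m∣n⇒∣m-n (∣n⇒∣m*n (X a) ℓ∣Xd) ℓ∣N)
      term : ∀ d → t (tr-1 a d) ℕ.* [ ℓ ∣ X a * X d - N ] ≡ t (+ a) ℕ.* [ ℓ ∣ X d ]
      term d rewrite ℓ∣X⇔ d = begin
        t (tr-1 a d) ℕ.* [ ℓ ∣ X d ]   ≡⟨ ℕ.*-comm (t (tr-1 a d)) _ ⟩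
        [ ℓ ∣ X d ] ℕ.* t (tr-1 a d)   ≡⟨ 𝟙*-cong (+ ℓ ∣? X d) (λ ℓ∣Xd → t-cong _ _ (∣-respʳ (sym (shift (+ a) (+ d))) (∣m⇒∣-m ℓ∣Xd))) ⟩
        [ ℓ ∣ X d ] ℕ.* t (+ a)        ≡⟨ ℕ.*-comm _ (t (+ a)) ⟩
        t (+ a) ℕ.* [ ℓ ∣ X d ]        ∎

    rows-ℓ∣N : + ℓ ∣ N → ∑ M row ≡ p ℕ.* τ ℕ.+ ω ℕ.* p
    rows-ℓ∣N ℓ∣N = begin
      ∑ M row                                                              ≡⟨ ∑-cong M split ⟩
      ∑[ a < M ] ([ ℓ ∣ X a ] ℕ.* τ ℕ.+ [ ℓ ∤ X a ] ℕ.* (t (+ a) ℕ.* p))   ≡⟨ ∑-distrib-+ M _ _ ⟩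
      ∑[ a < M ] ([ ℓ ∣ X a ] ℕ.* τ) ℕ.+ ∑[ a < M ] ([ ℓ ∤ X a ] ℕ.* (t (+ a) ℕ.* p))
        ≡⟨ cong₂ ℕ._+_ (trans (*-distribʳ-∑ M τ _) (cong (ℕ._* τ) count-X))
                       (trans (∑-cong M (λ a → sym (ℕ.*-assoc [ ℓ ∤ X a ] (t (+ a)) p))) (*-distribʳ-∑ M p _)) ⟩
      p ℕ.* τ ℕ.+ ω ℕ.* p                                                  ∎
      where
      open ≡-Reasoning
      split : ∀ a → row a ≡ [ ℓ ∣ X a ] ℕ.* τ ℕ.+ [ ℓ ∤ X a ] ℕ.* (t (+ a) ℕ.* p)
      split a = 𝟙-cases (+ ℓ ∣? X a) (row-ℓ∣X ℓ∣N a) (row-ℓ∤X ℓ∣N a)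

    rows-ℓ∤N : ¬ (+ ℓ ∣ N) → (∀ x → t x ≡ 1) → ∑ M row ≡ ω ℕ.* p
    rows-ℓ∤N ℓ∤N t≡1 = trans (∑-cong M row≡) (*-distribʳ-∑ M p _)
      where
      open ≡-Reasoning
      row≡ : ∀ a → row a ≡ [ ℓ ∤ X a ] ℕ.* t (+ a) ℕ.* p
      row≡ a rewrite t≡1 (+ a) with + ℓ ∣? X a
      ... | yes ℓ∣Xa = ∑-zero M λ d _ → trans (cong (t (tr-1 a d) ℕ.*_) (𝟙-no (_ ∣? _) λ ℓ∣ →
              ℓ∤N (∣-respʳ (cancel (X a * X d) N) (∣m∣n⇒∣m-n (∣m⇒∣m*n (X d) ℓ∣Xa) ℓ∣)))) (ℕ.*-zeroʳ (t (tr-1 a d)))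
        where
        cancel : ∀ x n → x - (x - n) ≡ n
        cancel = ℤ.solve-∀
      ... | no ℓ∤Xa = begin
        ∑[ d < M ] (t (tr-1 a d) ℕ.* [ ℓ ∣ X a * X d - N ])   ≡⟨ ∑-cong M (λ d → trans (cong₂ ℕ._*_ (t≡1 _) (cong [ ℓ ∣_] (shape (X a) (+ d) N)))
                                                                                       (ℕ.*-identityˡ _)) ⟩
        ∑[ d < M ] [ ℓ ∣ (X a - N) + (- X a) * + d ]           ≡⟨ count-prime-∣-linear pr j (X a - N) (- X a) (∤-neg (X a) ℓ∤Xa) ⟩
        p                                                     ≡⟨ sym (ℕ.*-identityˡ p) ⟩
        1 ℕ.* p                                               ∎
        where
        shape : ∀ x d n → x * (1ℤ - d) - n ≡ (x - n) + (- x) * d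
        shape = ℤ.solve-∀

    ℓ∣Xa*Xd : + ℓ ∣ N → ∀ a b c d → + ℓ ∣ + b → + M ∣ Δ a b c d → + ℓ ∣ (X a * X d)
    ℓ∣Xa*Xd ℓ∣N a b c d ℓ∣b M∣Δ =
      ∣-respʳ (cancel (X a * X d) (+ b * + c) N) (∣m∣n⇒∣m+n (∣m∣n⇒∣m+n (ℓ∣-of-M∣ M∣Δ) (∣m⇒∣m*n (+ c) ℓ∣b)) ℓ∣N)
      where
      cancel : ∀ x y n → x - y - n + y + n ≡ x
      cancel = ℤ.solve-∀

    W≡-ℓ∣N : + ℓ ∣ N →
             W ≡ φ ℕ.* (M ℕ.* τ) ℕ.+ φ ℕ.* (p ℕ.* τ ℕ.+ ω ℕ.* p) ℕ.+ p ℕ.* (p ℕ.* ω) ℕ.+ p ℕ.* (p ℕ.* ω) ℕ.+ t 1ℤ ℕ.* W⁰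
    W≡-ℓ∣N ℓ∣N =
      trans W-split (cong (ℕ._+ t 1ℤ ℕ.* W⁰)
        (cong₂ ℕ._+_ (cong₂ ℕ._+_ (cong₂ ℕ._+_ Wᵇ≡ (trans Wᶜ≡ (cong (φ ℕ.*_) (rows-ℓ∣N ℓ∣N)))) (Wᵃ≡ trace≡a)) (Wᵈ≡ trace≡d)))
      where
      trace≡a : TraceByA
      trace≡a a b c d ℓ∣b _ ℓ∤Xa M∣Δ with euclidsLemmaℤ pr (X a) (X d) (ℓ∣Xa*Xd ℓ∣N a b c d ℓ∣b M∣Δ)
      ... | inj₁ ℓ∣Xa = ⊥-elim (ℓ∤Xa ℓ∣Xa)
      ... | inj₂ ℓ∣Xd = t-cong _ _ (∣-respʳ (sym (shift (+ a) (+ d))) (∣m⇒∣-m ℓ∣Xd))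
        where
        shift : ∀ a d → a + d - 1ℤ - a ≡ - (1ℤ - d)
        shift = ℤ.solve-∀
      trace≡d : TraceByD
      trace≡d a b c d ℓ∣b _ ℓ∤Xd M∣Δ with euclidsLemmaℤ pr (X a) (X d) (ℓ∣Xa*Xd ℓ∣N a b c d ℓ∣b M∣Δ)
      ... | inj₂ ℓ∣Xd = ⊥-elim (ℓ∤Xd ℓ∣Xd)
      ... | inj₁ ℓ∣Xa = begin
        [ ℓ ∣ X a ] ℕ.* t (tr-1 a d)  ≡⟨ cong (ℕ._* t (tr-1 a d)) (𝟙-yes (_ ∣? _) ℓ∣Xa) ⟩
        1 ℕ.* t (tr-1 a d)            ≡⟨ ℕ.*-identityˡ _ ⟩
        t (tr-1 a d)                  ≡⟨ t-cong _ _ (∣-respʳ (sym (shift (+ a) (+ d))) (∣m⇒∣-m ℓ∣Xa)) ⟩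
        t (+ d)                       ∎
        where
        open ≡-Reasoning
        shift : ∀ a d → a + d - 1ℤ - d ≡ - (1ℤ - a)
        shift = ℤ.solve-∀

    W≡-ℓ∤N : ¬ (+ ℓ ∣ N) → (∀ x → t x ≡ 1) → W ≡ φ ℕ.* (M ℕ.* τ) ℕ.+ φ ℕ.* (ω ℕ.* p) ℕ.+ p ℕ.* (p ℕ.* ω)
    W≡-ℓ∤N ℓ∤N t≡1 = begin
      W                                           ≡⟨ W-split ⟩
      Wᵇ ℕ.+ Wᶜ ℕ.+ Wᵃ ℕ.+ Wᵈ ℕ.+ t 1ℤ ℕ.* W⁰    ≡⟨ cong₂ (λ x y → Wᵇ ℕ.+ Wᶜ ℕ.+ Wᵃ ℕ.+ x ℕ.+ t 1ℤ ℕ.* y) (Wᵈ≡0 ℓ∤N) (W⁰≡0-ℓ∤N ℓ∤N) ⟩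
      Wᵇ ℕ.+ Wᶜ ℕ.+ Wᵃ ℕ.+ 0 ℕ.+ t 1ℤ ℕ.* 0      ≡⟨ drop-zeros Wᵇ Wᶜ Wᵃ (t 1ℤ) ⟩
      Wᵇ ℕ.+ Wᶜ ℕ.+ Wᵃ                            ≡⟨ cong₂ ℕ._+_ (cong₂ ℕ._+_ Wᵇ≡ (trans Wᶜ≡ (cong (φ ℕ.*_) (rows-ℓ∤N ℓ∤N t≡1))))
                                                                 (Wᵃ≡ (λ a _ _ d _ _ _ _ → trans (t≡1 _) (sym (t≡1 _)))) ⟩
      φ ℕ.* (M ℕ.* τ) ℕ.+ φ ℕ.* (ω ℕ.* p) ℕ.+ p ℕ.* (p ℕ.* ω) ∎
      where
      open ≡-Reasoning
      drop-zeros : ∀ x y z w → x ℕ.+ y ℕ.+ z ℕ.+ 0 ℕ.+ w ℕ.* 0 ≡ x ℕ.+ y ℕ.+ z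
      drop-zeros = ℕ.solve-∀

module Rescaling where

  open import Data.Nat as ℕ using (ℕ; suc; _^_)
  import Data.Nat.Properties as ℕ
  open import Data.Nat.Primality using (Prime)
  open import Data.Integer hiding (suc; _^_; ∣_∣)
  open import Data.Integer.Properties using (pos-+)
  open import Relation.Nullary using (yes; no)
  open import Relation.Binary.PropositionalEquality hiding ([_])
  import Data.Integer.Tactic.RingSolver as ℤ
  import Data.Nat.Tactic.RingSolver as ℕ
  open FiniteSum
  open Congruence
  open LinearCongruence
  open Decomposition using (module Count; one; one-cong)

  module _ {ℓ : ℕ} (pr : Prime ℓ) (j : ℕ) where
    private
      M M₀ : ℕ
      M = ℓ ^ suc j
      M₀ = ℓ ^ j

    Respects : (ℤ → ℕ) → Set
    Respects F = ∀ x y → + M ∣ (x - y) → F x ≡ F y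

    -- Both sides sum F over the residues mod ℓ^(j+1) that are ≡ s (mod ℓ).
    ∑-residue-class : ∀ s (F : ℤ → ℕ) → Respects F →
                      ∑[ a < M ] ([ ℓ ∣ + a - s ] ℕ.* F (+ a)) ≡ ∑[ a′ < M₀ ] F (s + + ℓ * + a′)
    ∑-residue-class s F F-resp = sym (begin
      ∑[ a′ < M₀ ] F (s + + ℓ * + a′)
        ≡⟨ ∑-cong M₀ (λ a′ → sym (∑-linear-congruence pr (suc j) (- lift a′) 1ℤ (prime∤1 pr) (λ a → F (+ a)) _
                                   (λ a M∣ → F-resp (+ a) _ (∣-respʳ (diff (lift a′) (+ a)) M∣)))) ⟩
      ∑[ a′ < M₀ ] ∑[ a < M ] ([ M ∣ - lift a′ + 1ℤ * + a ] ℕ.* F (+ a))  ≡⟨ ∑-comm M₀ M _ ⟩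
      ∑[ a < M ] ∑[ a′ < M₀ ] ([ M ∣ - lift a′ + 1ℤ * + a ] ℕ.* F (+ a))  ≡⟨ ∑-cong M (λ a → *-distribʳ-∑ M₀ (F (+ a)) _) ⟩
      ∑[ a < M ] (∑[ a′ < M₀ ] [ M ∣ - lift a′ + 1ℤ * + a ] ℕ.* F (+ a))  ≡⟨ ∑-cong M (λ a → cong (ℕ._* F (+ a)) (lifts a)) ⟩
      ∑[ a < M ] ([ ℓ ∣ + a - s ] ℕ.* F (+ a))                           ∎)
      where
      open ≡-Reasoning
      lift : ℕ → ℤ
      lift a′ = s + + ℓ * + a′
      diff : ∀ y a → - y + 1ℤ * a ≡ a - y
      diff = ℤ.solve-∀
      -- a ≡ s (mod ℓ) has exactly one lift s + ℓ a′ (a′ mod ℓ^j) with a ≡ s + ℓ a′ (mod ℓ^(j+1)).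
      lifts : ∀ a → ∑[ a′ < M₀ ] [ M ∣ - lift a′ + 1ℤ * + a ] ≡ [ ℓ ∣ + a - s ]
      lifts a with + ℓ ∣? (+ a - s)
      ... | no ℓ∤a-s = ∑-zero M₀ (λ a′ _ → 𝟙-no (_ ∣? _) λ M∣ →
              ℓ∤a-s (∣-respʳ (cancel s (+ ℓ) (+ a′) (+ a))
                             (∣m∣n⇒∣m+n (∣-trans (ℓ∣ℓ^suc ℓ j) M∣) (∣n⇒∣m*n (+ a′) ∣-refl))))
        where
        cancel : ∀ s l a′ a → - (s + l * a′) + 1ℤ * a + a′ * l ≡ a - s
        cancel = ℤ.solve-∀
      ... | yes (divides w a-s≡wℓ) = begin
        ∑[ a′ < M₀ ] [ M ∣ - lift a′ + 1ℤ * + a ]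
          ≡⟨ ∑-cong M₀ (λ a′ → 𝟙-cong (_ ∣? _) (_ ∣? _)
               (λ M∣ → ℓ^suc∣ℓ*x⇒ℓ^∣x pr j _ (∣-respʳ (factor (+ a′)) M∣))
               (λ M₀∣ → ∣-respʳ (sym (factor (+ a′))) (ℓ^∣x⇒ℓ^suc∣ℓ*x ℓ j _ M₀∣))) ⟩
        ∑[ a′ < M₀ ] [ M₀ ∣ w + -1ℤ * + a′ ]                ≡⟨ count-linear-congruence pr j w -1ℤ (∤-neg 1ℤ (prime∤1 pr)) ⟩
        1                                                   ∎
        where
        factor : ∀ a′ → - (s + + ℓ * a′) + 1ℤ * + a ≡ + ℓ * (w + -1ℤ * a′)
        factor a′ = trans (regroup s (+ ℓ) a′ (+ a)) (trans (cong (_- + ℓ * a′) a-s≡wℓ) (expand w (+ ℓ) a′))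
          where
          regroup : ∀ s l a′ a → - (s + l * a′) + 1ℤ * a ≡ (a - s) - l * a′
          regroup = ℤ.solve-∀
          expand : ∀ w l a′ → w * l - l * a′ ≡ l * (w + -1ℤ * a′)
          expand = ℤ.solve-∀

    Respects⁴ : (ℤ → ℤ → ℤ → ℤ → ℕ) → Set
    Respects⁴ Φ = ∀ A A′ B B′ C C′ D D′ → + M ∣ (A - A′) → + M ∣ (B - B′) → + M ∣ (C - C′) → + M ∣ (D - D′) →
                  Φ A B C D ≡ Φ A′ B′ C′ D′

    ∑⁴-residue-class : ∀ sa sb sc sd (Φ : ℤ → ℤ → ℤ → ℤ → ℕ) → Respects⁴ Φ →
      ∑⁴ M (λ a b c d → [ ℓ ∣ + a - sa ] ℕ.* ([ ℓ ∣ + b - sb ] ℕ.* ([ ℓ ∣ + c - sc ] ℕ.* ([ ℓ ∣ + d - sd ] ℕ.* Φ (+ a) (+ b) (+ c) (+ d))))) ≡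
      ∑⁴ M₀ (λ a b c d → Φ (sa + + ℓ * + a) (sb + + ℓ * + b) (sc + + ℓ * + c) (sd + + ℓ * + d))
    ∑⁴-residue-class sa sb sc sd Φ Φ-resp = begin
      ∑⁴ M (λ a b c d → I sa a ℕ.* (I sb b ℕ.* (I sc c ℕ.* (I sd d ℕ.* Φ (+ a) (+ b) (+ c) (+ d)))))
        ≡⟨ ∑-cong M (λ a → *-distribˡ-∑³ M (I sa a) (λ b c d → I sb b ℕ.* (I sc c ℕ.* (I sd d ℕ.* Φ (+ a) (+ b) (+ c) (+ d))))) ⟩
      ∑[ a < M ] (I sa a ℕ.* Gᵃ (+ a))
        ≡⟨ ∑-residue-class sa Gᵃ Gᵃ-resp ⟩
      ∑[ a < M₀ ] Gᵃ (lift sa a)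
        ≡⟨ ∑-cong M₀ (λ a → trans (∑-cong M (λ b → *-distribˡ-∑² M (I sb b) (λ c d → I sc c ℕ.* (I sd d ℕ.* Φ (lift sa a) (+ b) (+ c) (+ d)))))
                                  (∑-residue-class sb (Gᵇ (lift sa a)) (Gᵇ-resp (lift sa a)))) ⟩
      ∑[ a < M₀ ] ∑[ b < M₀ ] Gᵇ (lift sa a) (lift sb b)
        ≡⟨ ∑-cong M₀ (λ a → ∑-cong M₀ (λ b → trans (∑-cong M (λ c → *-distribˡ-∑ M (I sc c) (λ d → I sd d ℕ.* Φ (lift sa a) (lift sb b) (+ c) (+ d))))
                                                   (∑-residue-class sc (Gᶜ (lift sa a) (lift sb b)) (Gᶜ-resp (lift sa a) (lift sb b))))) ⟩
      ∑[ a < M₀ ] ∑[ b < M₀ ] ∑[ c < M₀ ] Gᶜ (lift sa a) (lift sb b) (lift sc c)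
        ≡⟨ ∑-cong M₀ (λ a → ∑-cong M₀ (λ b → ∑-cong M₀ (λ c →
             ∑-residue-class sd (Φ (lift sa a) (lift sb b) (lift sc c)) (λ x y → Φ-resp (lift sa a) _ (lift sb b) _ (lift sc c) _ x y (∣x-x (lift sa a)) (∣x-x (lift sb b)) (∣x-x (lift sc c)))))) ⟩
      ∑⁴ M₀ (λ a b c d → Φ (lift sa a) (lift sb b) (lift sc c) (lift sd d)) ∎
      where
      open ≡-Reasoning
      I : ℤ → ℕ → ℕ
      I s x = [ ℓ ∣ + x - s ]
      lift : ℤ → ℕ → ℤ
      lift s x = s + + ℓ * + x
      Gᶜ : ℤ → ℤ → ℤ → ℕ
      Gᶜ A B C = ∑[ d < M ] (I sd d ℕ.* Φ A B C (+ d))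
      Gᵇ : ℤ → ℤ → ℕ
      Gᵇ A B = ∑[ c < M ] ∑[ d < M ] (I sc c ℕ.* (I sd d ℕ.* Φ A B (+ c) (+ d)))
      Gᵃ : ℤ → ℕ
      Gᵃ A = ∑[ b < M ] ∑[ c < M ] ∑[ d < M ] (I sb b ℕ.* (I sc c ℕ.* (I sd d ℕ.* Φ A (+ b) (+ c) (+ d))))
      Gᶜ-resp : ∀ A B → Respects (Gᶜ A B)
      Gᶜ-resp A B x y M∣ = ∑-cong M λ d → cong (I sd d ℕ.*_) (Φ-resp A A B B x y (+ d) (+ d) (∣x-x A) (∣x-x B) M∣ (∣x-x (+ d)))
      Gᵇ-resp : ∀ A → Respects (Gᵇ A)
      Gᵇ-resp A x y M∣ = ∑-cong M λ c → ∑-cong M λ d →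
        cong (λ z → I sc c ℕ.* (I sd d ℕ.* z)) (Φ-resp A A x y (+ c) (+ c) (+ d) (+ d) (∣x-x A) M∣ (∣x-x (+ c)) (∣x-x (+ d)))
      Gᵃ-resp : Respects Gᵃ
      Gᵃ-resp x y M∣ = ∑-cong M λ b → ∑-cong M λ c → ∑-cong M λ d →
        cong (λ z → I sb b ℕ.* (I sc c ℕ.* (I sd d ℕ.* z))) (Φ-resp x y (+ b) (+ b) (+ c) (+ c) (+ d) (+ d) M∣ (∣x-x (+ b)) (∣x-x (+ c)) (∣x-x (+ d)))

  module _ {ℓ : ℕ} (pr : Prime ℓ) (j : ℕ) (N′ : ℤ) where
    private
      module Big = Count pr (suc (suc j)) (+ ℓ * + ℓ * N′) one one-cong
      module Small = Count pr j N′ one one-cong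
      M M₀ M′ : ℕ
      M = ℓ ^ suc (suc (suc j))
      M₀ = ℓ ^ suc (suc j)
      M′ = ℓ ^ suc j
      N s₁ : ℤ
      N = + ℓ * + ℓ * N′
      s₁ = 1ℤ - + ℓ
      Φ : ℤ → ℤ → ℤ → ℤ → ℕ
      Φ A B C D = [ M ∣ defect N A B C D ]
      Ψ : ℕ → ℕ → ℕ → ℕ → ℕ
      Ψ a b c d = [ M′ ∣ defect N′ (+ a) (+ b) (+ c) (+ d) ]

    -- If ℓ divides every entry of I − σ, write σ = (1 − ℓ + ℓ a′, ℓ b′ ; ℓ c′, 1 − ℓ + ℓ d′), so that
    -- det (I − σ) = ℓ² det (I − σ′): the condition mod ℓ^(j+3) only sees σ′ mod ℓ^(j+1), which has ℓ⁴ lifts mod ℓ^(j+2).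
    W⁰-rescale : Big.W⁰ ≡ ℓ ℕ.* (ℓ ℕ.* (ℓ ℕ.* (ℓ ℕ.* Small.W)))
    W⁰-rescale = begin
      Big.W⁰
        ≡⟨ ∑⁴-cong M reorder ⟩
      ∑⁴ M (λ a b c d → I s₁ a ℕ.* (I 0ℤ b ℕ.* (I 0ℤ c ℕ.* (I s₁ d ℕ.* Φ (+ a) (+ b) (+ c) (+ d)))))
        ≡⟨ ∑⁴-residue-class pr (suc (suc j)) s₁ 0ℤ 0ℤ s₁ Φ Φ-resp ⟩
      ∑⁴ M₀ (λ a b c d → Φ (s₁ + + ℓ * + a) (0ℤ + + ℓ * + b) (0ℤ + + ℓ * + c) (s₁ + + ℓ * + d))
        ≡⟨ ∑⁴-cong M₀ scale ⟩
      ∑⁴ (ℓ ℕ.* M′) Ψ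
        ≡⟨ ∑⁴-periodic ℓ M′ Ψ (λ a b c d → Ψ-resp (+ (M′ ℕ.+ a)) (+ a) (+ b) (+ b) (+ c) (+ c) (+ d) (+ d) (M′∣M′+x-x a) (∣x-x (+ b)) (∣x-x (+ c)) (∣x-x (+ d)))
                             (λ a b c d → Ψ-resp (+ a) (+ a) (+ (M′ ℕ.+ b)) (+ b) (+ c) (+ c) (+ d) (+ d) (∣x-x (+ a)) (M′∣M′+x-x b) (∣x-x (+ c)) (∣x-x (+ d)))
                             (λ a b c d → Ψ-resp (+ a) (+ a) (+ b) (+ b) (+ (M′ ℕ.+ c)) (+ c) (+ d) (+ d) (∣x-x (+ a)) (∣x-x (+ b)) (M′∣M′+x-x c) (∣x-x (+ d)))
                             (λ a b c d → Ψ-resp (+ a) (+ a) (+ b) (+ b) (+ c) (+ c) (+ (M′ ℕ.+ d)) (+ d) (∣x-x (+ a)) (∣x-x (+ b)) (∣x-x (+ c)) (M′∣M′+x-x d)) ⟩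
      ℓ ℕ.* (ℓ ℕ.* (ℓ ℕ.* (ℓ ℕ.* ∑⁴ M′ Ψ)))
        ≡⟨ cong (λ z → ℓ ℕ.* (ℓ ℕ.* (ℓ ℕ.* (ℓ ℕ.* z)))) (∑⁴-cong M′ (λ a b c d → sym (ℕ.*-identityʳ (Ψ a b c d)))) ⟩
      ℓ ℕ.* (ℓ ℕ.* (ℓ ℕ.* (ℓ ℕ.* Small.W)))
        ∎
      where
      open ≡-Reasoning
      I : ℤ → ℕ → ℕ
      I s x = [ ℓ ∣ + x - s ]
      X≡s₁ : ∀ a → [ ℓ ∣ 1ℤ - + a ] ≡ I s₁ a
      X≡s₁ a = 𝟙-cong (_ ∣? _) (_ ∣? _)
        (λ ℓ∣ → ∣-respʳ (shift (+ a) (+ ℓ)) (∣m∣n⇒∣m+n (∣m⇒∣-m ℓ∣) ∣-refl))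
        (λ ℓ∣ → ∣-respʳ (unshift (+ a) (+ ℓ)) (∣m∣n⇒∣m-n ∣-refl ℓ∣))
        where
        shift : ∀ a l → - (1ℤ - a) + l ≡ a - (1ℤ - l)
        shift = ℤ.solve-∀
        unshift : ∀ a l → l - (a - (1ℤ - l)) ≡ 1ℤ - a
        unshift = ℤ.solve-∀
      x≡0 : ∀ b → [ ℓ ∣ + b ] ≡ I 0ℤ b
      x≡0 b = cong [ ℓ ∣_] (sym (+-identityʳ (+ b)))
        where open import Data.Integer.Properties using (+-identityʳ)
      permute : ∀ b c x y m → b ℕ.* (c ℕ.* (x ℕ.* (y ℕ.* m))) ≡ x ℕ.* (b ℕ.* (c ℕ.* (y ℕ.* m)))
      permute = ℕ.solve-∀
      reorder : ∀ a b c d → _ ≡ I s₁ a ℕ.* (I 0ℤ b ℕ.* (I 0ℤ c ℕ.* (I s₁ d ℕ.* Φ (+ a) (+ b) (+ c) (+ d))))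
      reorder a b c d =
        trans (permute [ ℓ ∣ + b ] [ ℓ ∣ + c ] [ ℓ ∣ 1ℤ - + a ] [ ℓ ∣ 1ℤ - + d ] (Φ (+ a) (+ b) (+ c) (+ d)))
              (cong₂ ℕ._*_ (X≡s₁ a) (cong₂ ℕ._*_ (x≡0 b) (cong₂ ℕ._*_ (x≡0 c) (cong (ℕ._* Φ (+ a) (+ b) (+ c) (+ d)) (X≡s₁ d)))))
      Φ-resp : Respects⁴ pr (suc (suc j)) Φ
      Φ-resp A A′ B B′ C C′ D D′ pa pb pc pd = [∣]-cong _ _ (defect-cong N A A′ B B′ C C′ D D′ pa pb pc pd)
      Ψ-resp : ∀ A A′ B B′ C C′ D D′ → + M′ ∣ (A - A′) → + M′ ∣ (B - B′) → + M′ ∣ (C - C′) → + M′ ∣ (D - D′) →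
               [ M′ ∣ defect N′ A B C D ] ≡ [ M′ ∣ defect N′ A′ B′ C′ D′ ]
      Ψ-resp A A′ B B′ C C′ D D′ pa pb pc pd = [∣]-cong _ _ (defect-cong N′ A A′ B B′ C C′ D D′ pa pb pc pd)
      M′∣M′+x-x : ∀ x → + M′ ∣ (+ (M′ ℕ.+ x) - + x)
      M′∣M′+x-x x = ∣-respʳ (sym (trans (cong (_- + x) (pos-+ M′ x)) (cancel (+ M′) (+ x)))) ∣-refl
        where
        cancel : ∀ m x → m + x - x ≡ m
        cancel = ℤ.solve-∀
      rescaled : ∀ l n a b c d →
        (1ℤ - (1ℤ - l + l * a)) * (1ℤ - (1ℤ - l + l * d)) - (0ℤ + l * b) * (0ℤ + l * c) - l * l * n ≡
        l * (l * ((1ℤ - a) * (1ℤ - d) - b * c - n))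
      rescaled = ℤ.solve-∀
      scale : ∀ a b c d → Φ (s₁ + + ℓ * + a) (0ℤ + + ℓ * + b) (0ℤ + + ℓ * + c) (s₁ + + ℓ * + d) ≡ Ψ a b c d
      scale a b c d = trans (cong [ M ∣_] (rescaled (+ ℓ) N′ (+ a) (+ b) (+ c) (+ d)))
        (𝟙-cong (_ ∣? _) (_ ∣? _)
          (λ M∣ → ℓ^suc∣ℓ*x⇒ℓ^∣x pr (suc j) _ (ℓ^suc∣ℓ*x⇒ℓ^∣x pr (suc (suc j)) _ M∣))
          (λ M′∣ → ℓ^∣x⇒ℓ^suc∣ℓ*x ℓ (suc (suc j)) _ (ℓ^∣x⇒ℓ^suc∣ℓ*x ℓ (suc j) _ M′∣)))

module Valuation where

  open import Defs using (IsVal)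
  open import Data.Nat
  open import Data.Nat.Properties using (*-assoc; *-comm)
  open import Data.Nat.Divisibility using (_∣_; divides; n∣m*n; *-monoʳ-∣)
  open import Data.Product using (Σ-syntax; _×_; _,_)
  open import Relation.Binary.PropositionalEquality

  IsVal-suc : ∀ {ℓ N v} → IsVal ℓ N (suc v) → Σ[ N′ ∈ ℕ ] (N ≡ ℓ * N′ × IsVal ℓ N′ v)
  IsVal-suc {ℓ} {N} {v} (divides k N≡kℓℓ^v , ℓ^v+2∤N) =
    k * ℓ ^ v , N≡ℓN′ , n∣m*n k , λ ℓ^v+1∣N′ → ℓ^v+2∤N (subst (ℓ ^ suc (suc v) ∣_) (sym N≡ℓN′) (*-monoʳ-∣ ℓ ℓ^v+1∣N′))
    where
    N≡ℓN′ : N ≡ ℓ * (k * ℓ ^ v)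
    N≡ℓN′ = trans N≡kℓℓ^v (trans (sym (*-assoc k ℓ (ℓ ^ v))) (trans (cong (_* ℓ ^ v) (*-comm k ℓ)) (*-assoc ℓ k (ℓ ^ v))))

module ClosedForm where

  open import Data.Nat as ℕ using (ℕ; zero; suc; _^_)
  import Data.Nat.Properties as ℕ
  import Data.Nat.Divisibility as ℕ
  open import Data.Nat.Primality using (Prime)
  open import Data.Integer hiding (suc; _^_; ∣_∣)
  open import Data.Integer.Properties using (pos-*; *-assoc)
  open import Data.Product using (_,_; Σ-syntax; _×_)
  open import Defs using (IsVal)
  open import Data.Empty using (⊥-elim)
  open import Relation.Nullary using (¬_; yes; no)
  open import Relation.Nullary.Decidable using (¬?)
  open import Relation.Binary.PropositionalEquality hiding ([_])
  import Data.Nat.Tactic.RingSolver as ℕ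
  import Data.Integer.Tactic.RingSolver as ℤ
  open FiniteSum
  open Congruence
  open LinearCongruence
  open Decomposition using (module Count; count-multiples; count-units; one; one-cong)
  open Rescaling using (W⁰-rescale)
  open Valuation

  IsVal-suc² : ∀ ℓ {N v} → IsVal ℓ N (suc (suc v)) → Σ[ N′ ∈ ℕ ] (+ N ≡ + ℓ * + ℓ * + N′ × IsVal ℓ N′ v)
  IsVal-suc² ℓ {v = v} val with IsVal-suc {ℓ} {v = suc v} val
  ... | N₁ , refl , val₁ with IsVal-suc {ℓ} {v = v} val₁
  ... | N₂ , refl , val₂ = N₂ , trans (pos-* ℓ (ℓ ℕ.* N₂)) (trans (cong (+ ℓ *_) (pos-* ℓ N₂)) (sym (*-assoc (+ ℓ) (+ ℓ) (+ N₂)))) , val₂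

  ℓ∣-of-IsVal : ∀ ℓ {N v} → IsVal ℓ N (suc v) → + ℓ ∣ + N
  ℓ∣-of-IsVal ℓ {v = v} (ℓ^v+1∣N , _) = ∣ᵤ⇒∣ (ℕ.∣-trans (ℕ.m∣m*n (ℓ ^ v)) ℓ^v+1∣N)

  ℓ²∤-of-IsVal : ∀ ℓ {N} → IsVal ℓ N 1 → ¬ (+ (ℓ ℕ.* ℓ) ∣ + N)
  ℓ²∤-of-IsVal ℓ {N} (_ , ℓ²∤N) ℓ²∣N = ℓ²∤N (subst (ℕ._∣ N) (cong (ℓ ℕ.*_) (sym (ℕ.*-identityʳ ℓ))) (∣⇒∣ᵤ ℓ²∣N))

  cancel-affine : ∀ {W K W′ A B X Y} c → W ≡ K ℕ.+ c ℕ.* W′ → W′ ℕ.+ X ≡ Y →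
                  K ℕ.+ A ℕ.+ c ℕ.* Y ≡ B ℕ.+ c ℕ.* X → W ℕ.+ A ≡ B
  cancel-affine {W} {K} {W′} {A} {B} {X} {Y} c refl W′+X≡Y K+A+cY≡B+cX = ℕ.+-cancelʳ-≡ (c ℕ.* X) _ _ (begin
    K ℕ.+ c ℕ.* W′ ℕ.+ A ℕ.+ c ℕ.* X  ≡⟨ regroup K c W′ A X ⟩
    K ℕ.+ A ℕ.+ c ℕ.* (W′ ℕ.+ X)      ≡⟨ cong (λ z → K ℕ.+ A ℕ.+ c ℕ.* z) W′+X≡Y ⟩
    K ℕ.+ A ℕ.+ c ℕ.* Y               ≡⟨ K+A+cY≡B+cX ⟩
    B ℕ.+ c ℕ.* X                     ∎)
    where
    open ≡-Reasoning
    regroup : ∀ K c W′ A X → K ℕ.+ c ℕ.* W′ ℕ.+ A ℕ.+ c ℕ.* X ≡ K ℕ.+ A ℕ.+ c ℕ.* (W′ ℕ.+ X)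
    regroup = ℕ.solve-∀

  -- The prime is written ℓ = 2 + q: the counts ℓ − 1 and ℓ − 2 become the polynomials 1 + q and q,
  -- and every closed form below becomes a semiring identity.
  minus-one : ∀ q p x → x ℕ.+ p ≡ (2 ℕ.+ q) ℕ.* p → x ≡ p ℕ.* (1 ℕ.+ q)
  minus-one q p x eq = ℕ.+-cancelʳ-≡ p x _ (trans eq (expand q p))
    where
    expand : ∀ q p → (2 ℕ.+ q) ℕ.* p ≡ p ℕ.* (1 ℕ.+ q) ℕ.+ p
    expand = ℕ.solve-∀

  minus-two : ∀ q p x → x ℕ.+ p ℕ.+ p ≡ (2 ℕ.+ q) ℕ.* p → x ≡ p ℕ.* q
  minus-two q p x eq = ℕ.+-cancelʳ-≡ p x _ (ℕ.+-cancelʳ-≡ p (x ℕ.+ p) _ (trans eq (expand q p)))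
    where
    expand : ∀ q p → (2 ℕ.+ q) ℕ.* p ≡ p ℕ.* q ℕ.+ p ℕ.+ p
    expand = ℕ.solve-∀

  module _ (q : ℕ) (pr : Prime (2 ℕ.+ q)) where

    ℓ : ℕ
    ℓ = 2 ℕ.+ q

    -- C₁ counts all σ with det (I − σ) ≡ N; Cᵤ only those with tr σ − 1 a unit mod ℓ, i.e. C_{N,n}(ℓ^(j+1)).
    module C₁ (j : ℕ) (N : ℤ) = Count pr j N one one-cong
    module Cᵤ (j : ℕ) (N : ℤ) = Count pr j N [ ℓ ∤_] [∤]-cong

    ω₁+p : ∀ j N → C₁.ω j N ℕ.+ ℓ ^ j ≡ ℓ ^ suc j
    ω₁+p j N = begin
      ω ℕ.+ ℓ ^ j                                                   ≡⟨ cong₂ ℕ._+_ (∑-cong M (λ a → ℕ.*-identityʳ _)) (sym count-X) ⟩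
      ∑[ a < M ] [ ℓ ∤ X a ] ℕ.+ ∑[ a < M ] [ ℓ ∣ X a ]             ≡⟨ sym (∑-distrib-+ M _ _) ⟩
      ∑[ a < M ] ([ ℓ ∤ X a ] ℕ.+ [ ℓ ∣ X a ])                      ≡⟨ ∑-cong M (λ a → [∤]+[∣] ℓ (X a)) ⟩
      ∑[ a < M ] 1                                                  ≡⟨ ∑-const M 1 ⟩
      M ℕ.* 1                                                       ≡⟨ ℕ.*-identityʳ M ⟩
      M                                                             ∎
      where
      open ≡-Reasoning
      open C₁ j N

    -- 1 − a and a are never both divisible by ℓ.
    ωᵤ+p+p : ∀ j N → Cᵤ.ω j N ℕ.+ ℓ ^ j ℕ.+ ℓ ^ j ≡ ℓ ^ suc j
    ωᵤ+p+p j N = begin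
      ω ℕ.+ ℓ ^ j ℕ.+ ℓ ^ j
        ≡⟨ cong₂ (λ x y → ω ℕ.+ x ℕ.+ y) (sym count-X) (sym (count-multiples pr j)) ⟩
      ω ℕ.+ ∑[ a < M ] [ ℓ ∣ X a ] ℕ.+ ∑[ a < M ] [ ℓ ∣ + a ]
        ≡⟨ cong (ℕ._+ ∑[ a < M ] [ ℓ ∣ + a ]) (sym (∑-distrib-+ M _ _)) ⟩
      ∑[ a < M ] ([ ℓ ∤ X a ] ℕ.* [ ℓ ∤ + a ] ℕ.+ [ ℓ ∣ X a ]) ℕ.+ ∑[ a < M ] [ ℓ ∣ + a ]
        ≡⟨ sym (∑-distrib-+ M _ _) ⟩
      ∑[ a < M ] ([ ℓ ∤ X a ] ℕ.* [ ℓ ∤ + a ] ℕ.+ [ ℓ ∣ X a ] ℕ.+ [ ℓ ∣ + a ])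
        ≡⟨ ∑-cong M partition ⟩
      ∑[ a < M ] 1                                                  ≡⟨ ∑-const M 1 ⟩
      M ℕ.* 1                                                       ≡⟨ ℕ.*-identityʳ M ⟩
      M                                                             ∎
      where
      open ≡-Reasoning
      open Cᵤ j N
      partition : ∀ a → [ ℓ ∤ X a ] ℕ.* [ ℓ ∤ + a ] ℕ.+ [ ℓ ∣ X a ] ℕ.+ [ ℓ ∣ + a ] ≡ 1
      partition a with + ℓ ∣? X a | + ℓ ∣? + a
      ... | yes ℓ∣Xa | yes ℓ∣a = ⊥-elim (prime∤1 pr (∣-respʳ (cancel (+ a)) (∣m∣n⇒∣m+n ℓ∣Xa ℓ∣a)))
        where
        cancel : ∀ a → 1ℤ - a + a ≡ 1ℤ
        cancel = ℤ.solve-∀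
      ... | yes _ | no _  = refl
      ... | no _  | yes _ = refl
      ... | no _  | no _  = refl

    K₁ Kᵤ : ℕ → ℕ
    K₁ p = p ℕ.* p ℕ.* p ℕ.* (1 ℕ.+ q) ℕ.* ((3 ℕ.+ q) ℕ.* (3 ℕ.+ q))
    Kᵤ p = p ℕ.* p ℕ.* p ℕ.* (3 ℕ.+ q) ℕ.* (q ℕ.* q ℕ.+ 3 ℕ.* q ℕ.+ 1)

    W₁-ℓ∣N : ∀ j N → + ℓ ∣ N → C₁.W j N ≡ K₁ (ℓ ^ j) ℕ.+ C₁.W⁰ j N
    W₁-ℓ∣N j N ℓ∣N = trans (W≡-ℓ∣N ℓ∣N) (expand (ℓ ^ j) φ ω W⁰ τ (count-units pr j) (ω₁+p j N) (∑-const M 1))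
      where
      open C₁ j N
      expand : ∀ p φ ω Z τ → φ ℕ.+ p ≡ ℓ ℕ.* p → ω ℕ.+ p ≡ ℓ ℕ.* p → τ ≡ ℓ ℕ.* p ℕ.* 1 →
        φ ℕ.* (ℓ ℕ.* p ℕ.* τ) ℕ.+ φ ℕ.* (p ℕ.* τ ℕ.+ ω ℕ.* p) ℕ.+ p ℕ.* (p ℕ.* ω) ℕ.+ p ℕ.* (p ℕ.* ω) ℕ.+ 1 ℕ.* Z ≡ K₁ p ℕ.+ Z
      expand p φ ω Z _ φ+p ω+p refl rewrite minus-one q p φ φ+p | minus-one q p ω ω+p = polynomial q p Z
        where
        polynomial : ∀ q p Z → let ℓ = 2 ℕ.+ q in
          p ℕ.* (1 ℕ.+ q) ℕ.* (ℓ ℕ.* p ℕ.* (ℓ ℕ.* p ℕ.* 1)) ℕ.+ p ℕ.* (1 ℕ.+ q) ℕ.* (p ℕ.* (ℓ ℕ.* p ℕ.* 1) ℕ.+ p ℕ.* (1 ℕ.+ q) ℕ.* p)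
            ℕ.+ p ℕ.* (p ℕ.* (p ℕ.* (1 ℕ.+ q))) ℕ.+ p ℕ.* (p ℕ.* (p ℕ.* (1 ℕ.+ q))) ℕ.+ 1 ℕ.* Z ≡
          p ℕ.* p ℕ.* p ℕ.* (1 ℕ.+ q) ℕ.* ((3 ℕ.+ q) ℕ.* (3 ℕ.+ q)) ℕ.+ Z
        polynomial = ℕ.solve-∀

    Wᵤ-ℓ∣N : ∀ j N → + ℓ ∣ N → Cᵤ.W j N ≡ Kᵤ (ℓ ^ j) ℕ.+ Cᵤ.W⁰ j N
    Wᵤ-ℓ∣N j N ℓ∣N = begin
      W                                                                                    ≡⟨ W≡-ℓ∣N ℓ∣N ⟩
      φ ℕ.* (M ℕ.* τ) ℕ.+ φ ℕ.* (p ℕ.* τ ℕ.+ ω ℕ.* p) ℕ.+ p ℕ.* (p ℕ.* ω) ℕ.+ p ℕ.* (p ℕ.* ω) ℕ.+ [ ℓ ∤ 1ℤ ] ℕ.* W⁰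
        ≡⟨ cong (λ z → φ ℕ.* (M ℕ.* τ) ℕ.+ φ ℕ.* (p ℕ.* τ ℕ.+ ω ℕ.* p) ℕ.+ p ℕ.* (p ℕ.* ω) ℕ.+ p ℕ.* (p ℕ.* ω) ℕ.+ z ℕ.* W⁰)
                (𝟙-yes (¬? (+ ℓ ∣? 1ℤ)) (prime∤1 pr)) ⟩
      φ ℕ.* (M ℕ.* τ) ℕ.+ φ ℕ.* (p ℕ.* τ ℕ.+ ω ℕ.* p) ℕ.+ p ℕ.* (p ℕ.* ω) ℕ.+ p ℕ.* (p ℕ.* ω) ℕ.+ 1 ℕ.* W⁰
        ≡⟨ expand p φ ω W⁰ (count-units pr j) (ωᵤ+p+p j N) ⟩
      Kᵤ p ℕ.+ W⁰                                                                          ∎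
      where
      open ≡-Reasoning
      open Cᵤ j N
      expand : ∀ p φ ω Z → φ ℕ.+ p ≡ ℓ ℕ.* p → ω ℕ.+ p ℕ.+ p ≡ ℓ ℕ.* p →
        φ ℕ.* (ℓ ℕ.* p ℕ.* φ) ℕ.+ φ ℕ.* (p ℕ.* φ ℕ.+ ω ℕ.* p) ℕ.+ p ℕ.* (p ℕ.* ω) ℕ.+ p ℕ.* (p ℕ.* ω) ℕ.+ 1 ℕ.* Z ≡ Kᵤ p ℕ.+ Z
      expand p φ ω Z φ+p ω+p+p rewrite minus-one q p φ φ+p | minus-two q p ω ω+p+p = polynomial q p Z
        where
        polynomial : ∀ q p Z → let ℓ = 2 ℕ.+ q in
          p ℕ.* (1 ℕ.+ q) ℕ.* (ℓ ℕ.* p ℕ.* (p ℕ.* (1 ℕ.+ q))) ℕ.+ p ℕ.* (1 ℕ.+ q) ℕ.* (p ℕ.* (p ℕ.* (1 ℕ.+ q)) ℕ.+ p ℕ.* q ℕ.* p)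
            ℕ.+ p ℕ.* (p ℕ.* (p ℕ.* q)) ℕ.+ p ℕ.* (p ℕ.* (p ℕ.* q)) ℕ.+ 1 ℕ.* Z ≡
          p ℕ.* p ℕ.* p ℕ.* (3 ℕ.+ q) ℕ.* (q ℕ.* q ℕ.+ 3 ℕ.* q ℕ.+ 1) ℕ.+ Z
        polynomial = ℕ.solve-∀

    W⁰-shrink : ∀ j N′ → C₁.W⁰ (suc (suc j)) (+ ℓ * + ℓ * N′) ≡ ℓ ℕ.* ℓ ℕ.* ℓ ℕ.* ℓ ℕ.* C₁.W j N′
    W⁰-shrink j N′ = trans (W⁰-rescale pr j N′) (fourfold ℓ (C₁.W j N′))
      where
      fourfold : ∀ ℓ x → ℓ ℕ.* (ℓ ℕ.* (ℓ ℕ.* (ℓ ℕ.* x))) ≡ ℓ ℕ.* ℓ ℕ.* ℓ ℕ.* ℓ ℕ.* x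
      fourfold = ℕ.solve-∀

    ℓ^[2+v+f]≡ : ∀ v f → ℓ ^ (suc (suc v) ℕ.+ f) ≡ ℓ ℕ.* (ℓ ℕ.* (ℓ ^ v ℕ.* ℓ ^ f))
    ℓ^[2+v+f]≡ v f = cong (λ x → ℓ ℕ.* (ℓ ℕ.* x)) (ℕ.^-distribˡ-+-* ℓ v f)

    ℓ∣ℓ²N′ : ∀ N′ → + ℓ ∣ + ℓ * + ℓ * N′
    ℓ∣ℓ²N′ N′ = ∣m⇒∣m*n N′ (∣m⇒∣m*n (+ ℓ) ∣-refl)

    P : ℕ → ℕ → ℕ
    P r s = r ℕ.* r ℕ.* (s ℕ.* s ℕ.* s) ℕ.* ℓ ℕ.* (ℓ ℕ.+ 1)

    -- W₁ = P r s (r ℓ − 1) and Wᵤ = P r s (r ℓ − r − 1), stated without truncated subtraction.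
    W₁-closed : ∀ v f N → IsVal ℓ N v → C₁.W (v ℕ.+ f) (+ N) ℕ.+ P (ℓ ^ v) (ℓ ^ f) ≡ P (ℓ ^ v) (ℓ ^ f) ℕ.* (ℓ ^ v ℕ.* ℓ)
    W₁-closed zero f N (_ , ℓ∤N) =
      trans (cong (ℕ._+ P 1 s) (W≡-ℓ∤N ℓ∤N′ (λ _ → refl))) (identity s φ ω τ (count-units pr f) (ω₁+p f (+ N)) (∑-const M 1))
      where
      open C₁ f (+ N)
      s : ℕ
      s = ℓ ^ f
      ℓ∤N′ : ¬ (+ ℓ ∣ + N)
      ℓ∤N′ ℓ∣N = ℓ∤N (subst (ℕ._∣ N) (sym (ℕ.*-identityʳ ℓ)) (∣⇒∣ᵤ ℓ∣N))
      identity : ∀ s φ ω τ → φ ℕ.+ s ≡ ℓ ℕ.* s → ω ℕ.+ s ≡ ℓ ℕ.* s → τ ≡ ℓ ℕ.* s ℕ.* 1 →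
        φ ℕ.* (ℓ ℕ.* s ℕ.* τ) ℕ.+ φ ℕ.* (ω ℕ.* s) ℕ.+ s ℕ.* (s ℕ.* ω) ℕ.+ P 1 s ≡ P 1 s ℕ.* (1 ℕ.* ℓ)
      identity s φ ω _ φ+s ω+s refl rewrite minus-one q s φ φ+s | minus-one q s ω ω+s = polynomial q s
        where
        polynomial : ∀ q s → let ℓ = 2 ℕ.+ q in
          s ℕ.* (1 ℕ.+ q) ℕ.* (ℓ ℕ.* s ℕ.* (ℓ ℕ.* s ℕ.* 1)) ℕ.+ s ℕ.* (1 ℕ.+ q) ℕ.* (s ℕ.* (1 ℕ.+ q) ℕ.* s)
            ℕ.+ s ℕ.* (s ℕ.* (s ℕ.* (1 ℕ.+ q))) ℕ.+ 1 ℕ.* 1 ℕ.* (s ℕ.* s ℕ.* s) ℕ.* ℓ ℕ.* (ℓ ℕ.+ 1) ≡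
          1 ℕ.* 1 ℕ.* (s ℕ.* s ℕ.* s) ℕ.* ℓ ℕ.* (ℓ ℕ.+ 1) ℕ.* (1 ℕ.* ℓ)
        polynomial = ℕ.solve-∀
    W₁-closed (suc zero) f N val = begin
      C₁.W (suc f) (+ N) ℕ.+ P (ℓ ℕ.* 1) s                 ≡⟨ cong (ℕ._+ P (ℓ ℕ.* 1) s) (W₁-ℓ∣N (suc f) (+ N) (ℓ∣-of-IsVal ℓ {v = 0} val)) ⟩
      K₁ (ℓ ℕ.* s) ℕ.+ C₁.W⁰ (suc f) (+ N) ℕ.+ P (ℓ ℕ.* 1) s
        ≡⟨ cong (λ z → K₁ (ℓ ℕ.* s) ℕ.+ z ℕ.+ P (ℓ ℕ.* 1) s) (C₁.W⁰≡0-ℓ²∤N (suc f) (+ N) (ℓ²∣ℓ^suc-suc ℓ f) (ℓ²∤-of-IsVal ℓ val)) ⟩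
      K₁ (ℓ ℕ.* s) ℕ.+ 0 ℕ.+ P (ℓ ℕ.* 1) s                 ≡⟨ polynomial q s ⟩
      P (ℓ ℕ.* 1) s ℕ.* (ℓ ℕ.* 1 ℕ.* ℓ)                    ∎
      where
      open ≡-Reasoning
      s : ℕ
      s = ℓ ^ f
      polynomial : ∀ q s → let ℓ = 2 ℕ.+ q; p = ℓ ℕ.* s in
        p ℕ.* p ℕ.* p ℕ.* (1 ℕ.+ q) ℕ.* ((3 ℕ.+ q) ℕ.* (3 ℕ.+ q)) ℕ.+ 0 ℕ.+ ℓ ℕ.* 1 ℕ.* (ℓ ℕ.* 1) ℕ.* (s ℕ.* s ℕ.* s) ℕ.* ℓ ℕ.* (ℓ ℕ.+ 1) ≡
        ℓ ℕ.* 1 ℕ.* (ℓ ℕ.* 1) ℕ.* (s ℕ.* s ℕ.* s) ℕ.* ℓ ℕ.* (ℓ ℕ.+ 1) ℕ.* (ℓ ℕ.* 1 ℕ.* ℓ)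
      polynomial = ℕ.solve-∀
    W₁-closed (suc (suc v)) f N val with IsVal-suc² ℓ {v = v} val
    ... | N′ , N≡ℓ²N′ , val′ rewrite N≡ℓ²N′ =
      cancel-affine {K = K₁ p} {X = P r s} (ℓ ℕ.* ℓ ℕ.* ℓ ℕ.* ℓ) W≡K+ℓ⁴W′ (W₁-closed v f N′ val′) (polynomial q r s)
      where
      r s p : ℕ
      r = ℓ ^ v
      s = ℓ ^ f
      p = ℓ ℕ.* (ℓ ℕ.* (r ℕ.* s))
      W≡K+ℓ⁴W′ : C₁.W (suc (suc v) ℕ.+ f) (+ ℓ * + ℓ * + N′) ≡ K₁ p ℕ.+ ℓ ℕ.* ℓ ℕ.* ℓ ℕ.* ℓ ℕ.* C₁.W (v ℕ.+ f) (+ N′)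
      W≡K+ℓ⁴W′ = trans (W₁-ℓ∣N (suc (suc (v ℕ.+ f))) (+ ℓ * + ℓ * + N′) (ℓ∣ℓ²N′ (+ N′))) (cong₂ ℕ._+_ (cong K₁ (ℓ^[2+v+f]≡ v f)) (W⁰-shrink (v ℕ.+ f) (+ N′)))
      polynomial : ∀ q r s →
        let ℓ = 2 ℕ.+ q; p = ℓ ℕ.* (ℓ ℕ.* (r ℕ.* s)); R = ℓ ℕ.* (ℓ ℕ.* r); c = ℓ ℕ.* ℓ ℕ.* ℓ ℕ.* ℓ
            P′ : ℕ → ℕ
            P′ x = x ℕ.* x ℕ.* (s ℕ.* s ℕ.* s) ℕ.* ℓ ℕ.* (ℓ ℕ.+ 1) in
        p ℕ.* p ℕ.* p ℕ.* (1 ℕ.+ q) ℕ.* ((3 ℕ.+ q) ℕ.* (3 ℕ.+ q)) ℕ.+ P′ R ℕ.+ c ℕ.* (P′ r ℕ.* (r ℕ.* ℓ)) ≡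
        P′ R ℕ.* (R ℕ.* ℓ) ℕ.+ c ℕ.* P′ r
      polynomial = ℕ.solve-∀

    Wᵤ-closed : ∀ v f N → IsVal ℓ N (suc v) →
                Cᵤ.W (suc v ℕ.+ f) (+ N) ℕ.+ P (ℓ ^ suc v) (ℓ ^ f) ℕ.* (ℓ ^ suc v ℕ.+ 1) ≡ P (ℓ ^ suc v) (ℓ ^ f) ℕ.* (ℓ ^ suc v ℕ.* ℓ)
    Wᵤ-closed zero f N val = begin
      Cᵤ.W (suc f) (+ N) ℕ.+ P′ ℕ.* (ℓ ℕ.* 1 ℕ.+ 1)             ≡⟨ cong (ℕ._+ P′ ℕ.* (ℓ ℕ.* 1 ℕ.+ 1)) (Wᵤ-ℓ∣N (suc f) (+ N) (ℓ∣-of-IsVal ℓ {v = 0} val)) ⟩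
      Kᵤ (ℓ ℕ.* s) ℕ.+ Cᵤ.W⁰ (suc f) (+ N) ℕ.+ P′ ℕ.* (ℓ ℕ.* 1 ℕ.+ 1)
        ≡⟨ cong (λ z → Kᵤ (ℓ ℕ.* s) ℕ.+ z ℕ.+ P′ ℕ.* (ℓ ℕ.* 1 ℕ.+ 1)) (Cᵤ.W⁰≡0-ℓ²∤N (suc f) (+ N) (ℓ²∣ℓ^suc-suc ℓ f) (ℓ²∤-of-IsVal ℓ val)) ⟩
      Kᵤ (ℓ ℕ.* s) ℕ.+ 0 ℕ.+ P′ ℕ.* (ℓ ℕ.* 1 ℕ.+ 1)             ≡⟨ polynomial q s ⟩
      P′ ℕ.* (ℓ ℕ.* 1 ℕ.* ℓ)                                    ∎
      where
      open ≡-Reasoning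
      s P′ : ℕ
      s = ℓ ^ f
      P′ = P (ℓ ℕ.* 1) s
      polynomial : ∀ q s → let ℓ = 2 ℕ.+ q; p = ℓ ℕ.* s; P′ = ℓ ℕ.* 1 ℕ.* (ℓ ℕ.* 1) ℕ.* (s ℕ.* s ℕ.* s) ℕ.* ℓ ℕ.* (ℓ ℕ.+ 1) in
        p ℕ.* p ℕ.* p ℕ.* (3 ℕ.+ q) ℕ.* (q ℕ.* q ℕ.+ 3 ℕ.* q ℕ.+ 1) ℕ.+ 0 ℕ.+ P′ ℕ.* (ℓ ℕ.* 1 ℕ.+ 1) ≡ P′ ℕ.* (ℓ ℕ.* 1 ℕ.* ℓ)
      polynomial = ℕ.solve-∀
    Wᵤ-closed (suc v) f N val with IsVal-suc² ℓ {v = v} val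
    ... | N′ , N≡ℓ²N′ , val′ rewrite N≡ℓ²N′ =
      cancel-affine {K = Kᵤ p} {X = P r s} (ℓ ℕ.* ℓ ℕ.* ℓ ℕ.* ℓ) W≡K+ℓ⁴W′ (W₁-closed v f N′ val′) (polynomial q r s)
      where
      r s p : ℕ
      r = ℓ ^ v
      s = ℓ ^ f
      p = ℓ ℕ.* (ℓ ℕ.* (r ℕ.* s))
      W≡K+ℓ⁴W′ : Cᵤ.W (suc (suc v) ℕ.+ f) (+ ℓ * + ℓ * + N′) ≡ Kᵤ p ℕ.+ ℓ ℕ.* ℓ ℕ.* ℓ ℕ.* ℓ ℕ.* C₁.W (v ℕ.+ f) (+ N′)
      W≡K+ℓ⁴W′ = trans (Wᵤ-ℓ∣N (suc (suc (v ℕ.+ f))) (+ ℓ * + ℓ * + N′) (ℓ∣ℓ²N′ (+ N′))) (cong₂ ℕ._+_ (cong Kᵤ (ℓ^[2+v+f]≡ v f)) (W⁰-shrink (v ℕ.+ f) (+ N′)))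
      polynomial : ∀ q r s →
        let ℓ = 2 ℕ.+ q; p = ℓ ℕ.* (ℓ ℕ.* (r ℕ.* s)); R = ℓ ℕ.* (ℓ ℕ.* r); c = ℓ ℕ.* ℓ ℕ.* ℓ ℕ.* ℓ
            P′ : ℕ → ℕ
            P′ x = x ℕ.* x ℕ.* (s ℕ.* s ℕ.* s) ℕ.* ℓ ℕ.* (ℓ ℕ.+ 1) in
        p ℕ.* p ℕ.* p ℕ.* (3 ℕ.+ q) ℕ.* (q ℕ.* q ℕ.+ 3 ℕ.* q ℕ.+ 1) ℕ.+ P′ R ℕ.* (R ℕ.+ 1) ℕ.+ c ℕ.* (P′ r ℕ.* (r ℕ.* ℓ)) ≡
        P′ R ℕ.* (R ℕ.* ℓ) ℕ.+ c ℕ.* P′ r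
      polynomial = ℕ.solve-∀

module Enumeration where

  open import Data.Nat as ℕ using (ℕ; zero; suc; _^_)
  import Data.Nat.Properties as ℕ
  import Data.Nat.Divisibility as ℕ
  open import Data.Nat.Primality using (Prime; prime⇒nonZero)
  open import Data.Integer hiding (suc; _^_; ∣_∣)
  open import Data.Fin as Fin using (Fin; toℕ; fromℕ<)
  open import Data.Fin.Properties using (toℕ-fromℕ<)
  open import Data.List using (List; _∷_; _++_; length; filter; concatMap; map; tabulate)
  open import Data.List.Properties using (filter-++; length-++)
  open import Data.Product using (_×_; _,_)
  open import Relation.Nullary using (Dec; yes; no; ¬_)
  open import Relation.Nullary.Decidable using (¬?; _×-dec_)
  open import Relation.Unary using (Pred; Decidable)
  open import Relation.Binary.PropositionalEquality hiding ([_])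
  open import Function using (_∘_; id)
  import Data.Integer.Tactic.RingSolver as ℤ
  open FiniteSum
  open Congruence
  open LinearCongruence
  open Decomposition using (module Count)
  open import Defs using (Mat2; InGL2; InC; InC?; cardC)

  𝟙-×-dec : ∀ {p q} {P : Set p} {Q : Set q} (P? : Dec P) (Q? : Dec Q) → 𝟙 (P? ×-dec Q?) ≡ 𝟙 P? ℕ.* 𝟙 Q?
  𝟙-×-dec (yes _) (yes _) = refl
  𝟙-×-dec (yes _) (no _)  = refl
  𝟙-×-dec (no _)  _       = refl

  module _ {a p} {A : Set a} {P : Pred A p} (P? : Decidable P) where

    length-filter-∷ : ∀ x (xs : List A) → length (filter P? (x ∷ xs)) ≡ 𝟙 (P? x) ℕ.+ length (filter P? xs)
    length-filter-∷ x xs with P? x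
    ... | yes _ = refl
    ... | no _  = refl

    length-filter-concatMap : ∀ {b} {B : Set b} n (h : Fin n → B) (f : B → List A) (G : ℕ → ℕ) →
      (∀ i → length (filter P? (f (h i))) ≡ G (toℕ i)) → length (filter P? (concatMap f (tabulate h))) ≡ ∑ n G
    length-filter-concatMap zero    h f G eq = refl
    length-filter-concatMap (suc n) h f G eq = begin
      length (filter P? (f (h Fin.zero) ++ concatMap f (tabulate (h ∘ Fin.suc))))
        ≡⟨ cong length (filter-++ P? (f (h Fin.zero)) _) ⟩
      length (filter P? (f (h Fin.zero)) ++ filter P? (concatMap f (tabulate (h ∘ Fin.suc))))
        ≡⟨ length-++ (filter P? (f (h Fin.zero))) ⟩
      length (filter P? (f (h Fin.zero))) ℕ.+ length (filter P? (concatMap f (tabulate (h ∘ Fin.suc))))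
        ≡⟨ cong₂ ℕ._+_ (eq Fin.zero) (length-filter-concatMap n (h ∘ Fin.suc) f (G ∘ suc) (eq ∘ Fin.suc)) ⟩
      ∑ (suc n) G ∎
      where
      open ≡-Reasoning

    length-filter-map : ∀ {b} {B : Set b} n (h : Fin n → B) (g : B → A) (G : ℕ → ℕ) →
      (∀ i → 𝟙 (P? (g (h i))) ≡ G (toℕ i)) → length (filter P? (map g (tabulate h))) ≡ ∑ n G
    length-filter-map zero    h g G eq = refl
    length-filter-map (suc n) h g G eq =
      trans (length-filter-∷ (g (h Fin.zero)) _)
            (cong₂ ℕ._+_ (eq Fin.zero) (length-filter-map n (h ∘ Fin.suc) g (G ∘ suc) (eq ∘ Fin.suc)))

  cardC≡∑⁴ : ∀ ℓ e N k (F : ℕ → ℕ → ℕ → ℕ → ℕ) →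
    (∀ (a b c d : Fin (ℓ ^ e)) → 𝟙 (InC? ℓ e N k (a , b , c , d)) ≡ F (toℕ a) (toℕ b) (toℕ c) (toℕ d)) →
    cardC ℓ e N k ≡ ∑⁴ (ℓ ^ e) F
  cardC≡∑⁴ ℓ e N k F eq =
    length-filter-concatMap P? M id _ _ λ a →
      length-filter-concatMap P? M id _ _ λ b →
        length-filter-concatMap P? M id _ _ λ c →
          length-filter-map P? M id _ _ λ d → eq a b c d
    where
    M : ℕ
    M = ℓ ^ e
    P? : Decidable (InC ℓ e N k)
    P? = InC? ℓ e N k

  module _ {ℓ : ℕ} (pr : Prime ℓ) (j N : ℕ) (ℓ∣N : + ℓ ∣ + N) (a b c d : Fin (ℓ ^ suc j)) where
    private
      open Count pr j (+ N) [ ℓ ∤_] [∤]-cong using (M; ℓ∣-of-M∣; tr-1)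
      instance
        M≢0 : ℕ.NonZero M
        M≢0 = ℕ.m^n≢0 ℓ (suc j) {{prime⇒nonZero pr}}
      σ : Mat2 M
      σ = (a , b , c , d)
      A B C D Δ det trace : ℤ
      A = + toℕ a
      B = + toℕ b
      C = + toℕ c
      D = + toℕ d
      Δ = defect (+ N) A B C D
      det = A * D - B * C
      trace = tr-1 (toℕ a) (toℕ d)
      congruence≡Δ : ∀ A B C D n → A * D - B * C + 1ℤ - (A + D) - n ≡ (1ℤ - A) * (1ℤ - D) - B * C - n
      congruence≡Δ = ℤ.solve-∀
      -- det σ = Δ + N + (tr σ − 1), and ℓ divides Δ and N: det σ is a unit mod ℓ iff tr σ − 1 is.
      det-split : ∀ A B C D n → A * D - B * C ≡ ((1ℤ - A) * (1ℤ - D) - B * C - n) + n + (A + D - 1ℤ)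
      det-split = ℤ.solve-∀

      InC⇒ : InC ℓ (suc j) N 0 σ → (+ M ∣ Δ) × ¬ (+ ℓ ∣ trace)
      InC⇒ ((u , det*u≡1) , congruent , _) = M∣Δ , λ ℓ∣trace →
        prime∤1 pr (∣-respʳ (cancel det (+ toℕ u))
          (∣m∣n⇒∣m-n (∣m⇒∣m*n (+ toℕ u) (ℓ∣det ℓ∣trace)) (ℓ∣-of-M∣ (∣ᵤ⇒∣ det*u≡1))))
        where
        M∣Δ : + M ∣ Δ
        M∣Δ = ∣-respʳ (congruence≡Δ A B C D (+ N)) (∣ᵤ⇒∣ congruent)
        ℓ∣det : + ℓ ∣ trace → + ℓ ∣ det
        ℓ∣det ℓ∣trace = ∣-respʳ (sym (det-split A B C D (+ N))) (∣m∣n⇒∣m+n (∣m∣n⇒∣m+n (ℓ∣-of-M∣ M∣Δ) ℓ∣N) ℓ∣trace)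
        cancel : ∀ x u → x * u - (x * u - 1ℤ) ≡ 1ℤ
        cancel = ℤ.solve-∀

      ⇒InC : (+ M ∣ Δ) × ¬ (+ ℓ ∣ trace) → InC ℓ (suc j) N 0 σ
      ⇒InC (M∣Δ , ℓ∤trace) =
        invertible , ∣⇒∣ᵤ (∣-respʳ (sym (congruence≡Δ A B C D (+ N))) M∣Δ) , (ℕ.1∣ _ , ℕ.1∣ _ , ℕ.1∣ _ , ℕ.1∣ _)
        where
        cancel : ∀ x n t → x + n + t - x - n ≡ t
        cancel = ℤ.solve-∀
        ℓ∤det : ¬ (+ ℓ ∣ det)
        ℓ∤det ℓ∣det = ℓ∤trace (∣-respʳ (cancel Δ (+ N) trace)
          (∣m∣n⇒∣m-n (∣m∣n⇒∣m-n (∣-respʳ (det-split A B C D (+ N)) ℓ∣det) (ℓ∣-of-M∣ M∣Δ)) ℓ∣N))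
        regroup : ∀ x i u → x * (i - u) + (x * u - 1ℤ) ≡ x * i - 1ℤ
        regroup = ℤ.solve-∀
        invertible : InGL2 M σ
        invertible with inverse-mod-prime-power pr det ℓ∤det (suc j)
        ... | u , M∣det*u-1 with representative M u
        ... | i , i<M , M∣i-u = fromℕ< i<M , ∣⇒∣ᵤ (subst (λ k → + M ∣ (det * + k - 1ℤ)) (sym (toℕ-fromℕ< i<M))
              (∣-respʳ (regroup det (+ i) u) (∣m∣n⇒∣m+n (∣n⇒∣m*n det M∣i-u) M∣det*u-1)))

    𝟙-InC : 𝟙 (InC? ℓ (suc j) N 0 σ) ≡ Count.F pr j (+ N) [ ℓ ∤_] [∤]-cong (toℕ a) (toℕ b) (toℕ c) (toℕ d)
    𝟙-InC = trans (𝟙-cong (InC? ℓ (suc j) N 0 σ) (+ M ∣? Δ ×-dec ¬? (+ ℓ ∣? trace)) InC⇒ ⇒InC)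
                  (𝟙-×-dec (+ M ∣? Δ) (¬? (+ ℓ ∣? trace)))

open import Defs
open import Data.Nat using (ℕ; _^_; _*_; _+_; _∸_; _<_; _≥_; suc)
open import Data.Nat.Divisibility using (_∣_)
open import Data.Nat.Primality using (Prime)
open import Relation.Nullary using (¬_)
open import Relation.Binary.PropositionalEquality using (_≡_)

open import Data.Nat using (zero)
open import Data.Nat.Properties using (m≤n⇒∃[o]m+o≡n; m+n∸n≡m; m+n∸m≡n; *-distribˡ-∸; ∸-+-assoc; ^-distribˡ-+-*; *-identityʳ)
open import Data.Nat.Divisibility using (∣-trans; m∣m*n)
open import Data.Integer using (+_)
open import Data.Product using (_,_)
open import Data.Empty using (⊥-elim)
open import Relation.Binary.PropositionalEquality using (refl; sym; trans; cong; cong₂; module ≡-Reasoning)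
import Data.Nat.Tactic.RingSolver as ℕ
open Congruence using (prime≥2)
open ClosedForm
open Enumeration

private
  unit-valuation : ∀ {ℓ n k} → IsVal ℓ n k → ¬ (ℓ ∣ n) → k ≡ 0
  unit-valuation {k = zero}      _             _   = refl
  unit-valuation {ℓ} {k = suc k} (ℓ^k+1∣n , _) ℓ∤n = ⊥-elim (ℓ∤n (∣-trans (m∣m*n (ℓ ^ k)) ℓ^k+1∣n))

  exponent : ∀ v f → 3 * (suc v + f) ∸ v ∸ 2 ≡ v + v + (f + f + f) + 1
  exponent v f = begin
    3 * (suc v + f) ∸ v ∸ 2                     ≡⟨ cong (λ x → x ∸ v ∸ 2) (expand v f) ⟩
    v + (v + v + (f + f + f) + 1 + 2) ∸ v ∸ 2   ≡⟨ cong (_∸ 2) (m+n∸m≡n v _) ⟩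
    v + v + (f + f + f) + 1 + 2 ∸ 2             ≡⟨ m+n∸n≡m _ 2 ⟩
    v + v + (f + f + f) + 1                     ∎
    where
    open ≡-Reasoning
    expand : ∀ v f → 3 * (suc v + f) ≡ v + (v + v + (f + f + f) + 1 + 2)
    expand = ℕ.solve-∀

  power : ∀ ℓ v f → ℓ ^ (3 * (suc v + f) ∸ v ∸ 2) ≡ ℓ ^ v * ℓ ^ v * (ℓ ^ f * ℓ ^ f * ℓ ^ f) * ℓ
  power ℓ v f rewrite exponent v f
                    | ^-distribˡ-+-* ℓ (v + v + (f + f + f)) 1 | ^-distribˡ-+-* ℓ (v + v) (f + f + f)
                    | ^-distribˡ-+-* ℓ v v | ^-distribˡ-+-* ℓ (f + f) f | ^-distribˡ-+-* ℓ f f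
                    | *-identityʳ ℓ = refl

propositionA7 : (ℓ n N : ℕ) → Prime ℓ → n ≥ 1 → N ≥ 1 → (n * n) ∣ N → ¬ (ℓ ∣ n)
    → (v : ℕ) → IsVal ℓ N v → v ≥ 1
    → (k : ℕ) → IsVal ℓ n k
    → (e : ℕ) → v < e
    → cardC ℓ e N k ≡ ℓ ^ (3 * e ∸ v ∸ 2) * (ℓ + 1) * (ℓ ^ (v + 1) ∸ ℓ ^ v ∸ 1)
propositionA7 ℓ n N pr _ _ _ ℓ∤n v val v≥1 k val-n e v<e
  with unit-valuation {ℓ} {k = k} val-n ℓ∤n
     | m≤n⇒∃[o]m+o≡n (prime≥2 pr) | m≤n⇒∃[o]m+o≡n v≥1 | m≤n⇒∃[o]m+o≡n v<e
... | refl | q , refl | v′ , refl | f , refl = begin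
  cardC ℓ (suc j) N 0                         ≡⟨ cardC≡∑⁴ ℓ (suc j) N 0 _ (𝟙-InC pr j N (ℓ∣-of-IsVal ℓ {v = v′} val)) ⟩
  Cᵤ.W q pr j (+ N)                           ≡⟨ solve-for-W (Wᵤ-closed q pr v′ f N val) ⟩
  P q pr r s * (r * ℓ) ∸ P q pr r s * (r + 1) ≡⟨ sym (*-distribˡ-∸ (P q pr r s) (r * ℓ) (r + 1)) ⟩
  P q pr r s * (r * ℓ ∸ (r + 1))              ≡⟨ cong₂ _*_ (cong (_* (ℓ + 1)) (sym (power ℓ v f)))
                                                           (trans (cong (_∸ (r + 1)) (sym ℓ^[v+1]≡rℓ))
                                                                  (sym (∸-+-assoc (ℓ ^ (v + 1)) r 1))) ⟩
  ℓ ^ (3 * e ∸ v ∸ 2) * (ℓ + 1) * (ℓ ^ (v + 1) ∸ ℓ ^ v ∸ 1) ∎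
  where
  open ≡-Reasoning
  j r s : ℕ
  j = v + f
  r = ℓ ^ v
  s = ℓ ^ f
  ℓ^[v+1]≡rℓ : ℓ ^ (v + 1) ≡ r * ℓ
  ℓ^[v+1]≡rℓ = trans (^-distribˡ-+-* ℓ v 1) (cong (r *_) (*-identityʳ ℓ))
  solve-for-W : ∀ {W X Y} → W + X ≡ Y → W ≡ Y ∸ X
  solve-for-W {W} {X} refl = sym (m+n∸n≡m W X)
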